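{- For all integers $m,r\ge 0$, $$P_{m+r,m}(x)=\begin{cases}1 & \text{if } (m,r)=(0,0),\\[2pt] \sum_{k=1}^{m}\frac{1}{k}\binom{m-1}{k-1}\binom{m}{k-1}x^{k-1} & \text{if } r=0,\ m\ge 1,\\[2pt] x\sum_{i=0}^{m}\sum_{j=0}^{r-1}P_{m-i,m-i}(x)\,P_{r-j-1,r-j-1}(x)\,P_{j+i,i}(x) & \text{if } r\ge 1,\end{cases}$$ where $P_{n,m}(x)=\sum_{k=0}^{n}p_{n,m,k}x^k$.
   Context: A Dyck path of semilength $n\ge 0$ is a lattice path in $\mathbb{Z}\times\mathbb{Z}$ from $(0,0)$ to $(2n,0)$ using up steps $U=(1,1)$ and down steps $D=(1,-1)$; it is allowed to go below the $x$-axis. Write it as a word $P_1P_2\cdots P_{2n}$ over $\{U,D\}$. An up step is under the $x$-axis if it goes from height $-h$ to height $-h+1$ for some $h\ge 1$. A Dyck path is $(n,m)$-flawed if it has semilength $n$ and exactly $m$ up steps under the $x$-axis. A peak is a position $i$ with $P_iP_{i+1}=UD$. Let $p_{n,m,k}$ be the number of $(n,m)$-flawed paths with exactly $k$ peaks (the empty path has $0$ peaks). -}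

module Defs where

open import Data.Nat using (ℕ; zero; suc; _+_; _*_; _∸_; _≤_; _≟_)
open import Data.Nat.Combinatorics using (_C_)
open import Data.Integer as ℤ using (ℤ; +_; -[1+_])
open import Data.List using (List; []; _∷_; map; _++_; filter; length)
open import Data.Product using (_×_)
open import Relation.Nullary using (Dec; yes; no)
open import Relation.Nullary.Decidable using (_×-dec_)
open import Data.Rational as ℚ using (ℚ)

-- Steps of a lattice path: U = (1,1), D = (1,-1).
data Step : Set where
  U D : Step

words : ℕ → List (List Step)
words zero    = [] ∷ []
words (suc l) = map (U ∷_) (words l) ++ map (D ∷_) (words l)

endHeight : ℤ → List Step → ℤ
endHeight h []      = h
endHeight h (U ∷ w) = endHeight (h ℤ.+ ℤ.1ℤ) w
endHeight h (D ∷ w) = endHeight (h ℤ.- ℤ.1ℤ) w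

negInd : ℤ → ℕ
negInd (+ _)    = 0
negInd -[1+ _ ] = 1

underUps : ℤ → List Step → ℕ
underUps h []      = 0
underUps h (U ∷ w) = negInd h + underUps (h ℤ.+ ℤ.1ℤ) w
underUps h (D ∷ w) = underUps (h ℤ.- ℤ.1ℤ) w

peaks : List Step → ℕ
peaks []           = 0
peaks (U ∷ D ∷ w)  = suc (peaks (D ∷ w))
peaks (_ ∷ w)      = peaks w

good : ℕ → ℕ → List Step → Set
good m k w = (endHeight (+ 0) w ≡ + 0) × (underUps (+ 0) w ≡ m) × (peaks w ≡ k)
  where open import Relation.Binary.PropositionalEquality using (_≡_)

good? : ∀ m k w → Dec (good m k w)
good? m k w = (endHeight (+ 0) w ℤ.≟ + 0) ×-dec (underUps (+ 0) w ≟ m) ×-dec (peaks w ≟ k)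

-- p n m k : number of (n,m)-flawed Dyck paths with exactly k peaks.
p : ℕ → ℕ → ℕ → ℕ
p n m k = length (filter (good? m k) (words (2 * n)))

-- Polynomials with natural coefficients, represented by their coefficient sequence.
Poly : Set
Poly = ℕ → ℕ

P : ℕ → ℕ → Poly
P n m e with e Data.Nat.≤? n
  where import Data.Nat
... | yes _ = p n m e
... | no  _ = 0

sumTo : ℕ → (ℕ → ℕ) → ℕ
sumTo zero    f = f 0
sumTo (suc n) f = sumTo n f + f (suc n)

onePoly : Poly
onePoly zero    = 1
onePoly (suc _) = 0

_⊗_ : Poly → Poly → Poly
(f ⊗ g) d = sumTo d (λ a → f a * g (d ∸ a))

xTimes : Poly → Poly
xTimes f zero    = 0
xTimes f (suc d) = f d

polySum : ℕ → (ℕ → Poly) → Poly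
polySum n F d = sumTo n (λ i → F i d)

-- Coefficient of x^e in Σ_{k=1}^{m} (1/k) C(m-1,k-1) C(m,k-1) x^{k-1}, as a rational
-- (term with k = e+1 if e+1 ≤ m, else 0).
narayanaCoeff : ℕ → ℕ → ℚ
narayanaCoeff m e with suc e Data.Nat.≤? m
  where import Data.Nat
... | yes _ = (+ (((m ∸ 1) C e) * (m C e))) ℚ./ suc e
... | no  _ = ℚ.0ℚ

toℚ : ℕ → ℚ
toℚ n = (+ n) ℚ./ 1

-- P n m is the generating polynomial, by peaks, of the words of length 2n weighted by
-- [the word returns to the axis] · [exactly m of its up steps start below the axis].
--
-- For r ≥ 1 a flawed path of semilength m + r rises above the axis, so it splits uniquely as
-- u · U (reflect a) D · b: u stays weakly below the axis and ends on it just before the first up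
-- step from the axis, U (reflect a) D is the first excursion above the axis (a is a nonpositive
-- Dyck path), and b is an arbitrary flawed path. All up steps of u are flaws, none of the
-- excursion's are, and the excursion adds one peak; so the three independent factors multiply to
-- x · (P ⊗ P) ⊗ P, after discarding odd lengths and reindexing by i = m − |u|/2, j = |b|/2 − i.
--
-- For r = 0 every up step is a flaw, so the path never rises above the axis. Counting such paths
-- from depth d, of length d + 2h and with k peaks, gives C(d+h,k) C(h,k) − C(d+h−1,k−1) C(h+1,k+1),
-- proved by induction on the length together with the count of peaks after a prepended up step;
-- at d = 0 the absorption identity turns this into the Narayana number (1/(k+1)) C(h−1,k) C(h,k).

module Submission where

open import Defs
open import Data.Bool using (Bool; true; false; _∧_)
open import Data.Empty using (⊥; ⊥-elim)
open import Data.Integer as ℤ using (ℤ; +0; +[1+_]; -[1+_])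
import Data.Integer.Properties as ℤ
import Data.Integer.Tactic.RingSolver as ℤ-RingSolver
open import Data.List using (List; []; _∷_; _++_; map; filter; length)
open import Data.List.Properties using (map-++; map-∘)
open import Data.Nat using (ℕ; zero; suc; _+_; _*_; _∸_; _≤_; _<_; z≤n; s≤s; _≟_; _≤?_)
open import Data.Nat.Combinatorics using (_C_; nCk+nC[k+1]≡[n+1]C[k+1])
open import Data.Nat.ListAction using (sum)
open import Data.Nat.ListAction.Properties using (sum-++)
open import Data.Nat.Properties
open import Algebra.Properties.CommutativeSemigroup +-commutativeSemigroup using () renaming (interchange to +-interchange)
open import Algebra.Properties.CommutativeSemigroup *-commutativeSemigroup using () renaming (x∙yz≈y∙xz to x*[y*z]≡y*[x*z])
open import Data.Nat.Tactic.RingSolver using (solve-∀)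
open import Data.Product using (_×_; _,_; ∃; proj₁; proj₂)
import Data.Rational as ℚ
open import Data.Rational.Properties using (fromℚᵘ-cong)
open import Data.Rational.Unnormalised.Base using (mkℚᵘ; *≡*)
open import Data.Sum using (inj₁; inj₂)
open import Function using (case_of_)
open import Relation.Binary.PropositionalEquality
open import Relation.Nullary using (Dec; yes; no; does)
open import Relation.Nullary.Decidable using (dec-false)
open ≡-Reasoning

𝟙 : Bool → ℕ
𝟙 true  = 1
𝟙 false = 0

𝟙-true-* : ∀ b {x y} → (b ≡ true → x ≡ y) → 𝟙 b * x ≡ 𝟙 b * y
𝟙-true-* true  x≡y = cong (_+ 0) (x≡y refl)
𝟙-true-* false _   = refl

𝟙-true-*-0 : ∀ b {x} → (b ≡ true → x ≡ 0) → 𝟙 b * x ≡ 0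
𝟙-true-*-0 b x≡0 = trans (𝟙-true-* b x≡0) (*-zeroʳ (𝟙 b))

δ : ℕ → ℕ → ℕ
δ x y = 𝟙 (does (x ≟ y))

δ-≢ : ∀ {x y} → x ≢ y → δ x y ≡ 0
δ-≢ {x} {y} x≢y = cong 𝟙 (dec-false (x ≟ y) x≢y)

δ-refl : ∀ x → δ x x ≡ 1
δ-refl zero    = refl
δ-refl (suc x) = δ-refl x

δ-+ˡ : ∀ s x m → s ≤ m → δ (s + x) m ≡ δ x (m ∸ s)
δ-+ˡ zero    x m       _         = refl
δ-+ˡ (suc s) x (suc m) (s≤s s≤m) = δ-+ˡ s x m s≤m

δ-+ˡ-> : ∀ s x m → m < s → δ (s + x) m ≡ 0
δ-+ˡ-> (suc s) x zero    _         = refl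
δ-+ˡ-> (suc s) x (suc m) (s≤s m<s) = δ-+ˡ-> s x m m<s

sumTo-cong : ∀ N {f g} → (∀ i → f i ≡ g i) → sumTo N f ≡ sumTo N g
sumTo-cong zero    f≗g = f≗g 0
sumTo-cong (suc N) f≗g = cong₂ _+_ (sumTo-cong N f≗g) (f≗g (suc N))

sumTo-cong-≤ : ∀ N {f g} → (∀ i → i ≤ N → f i ≡ g i) → sumTo N f ≡ sumTo N g
sumTo-cong-≤ zero    f≗g = f≗g 0 z≤n
sumTo-cong-≤ (suc N) f≗g =
  cong₂ _+_ (sumTo-cong-≤ N (λ i i≤N → f≗g i (m≤n⇒m≤1+n i≤N))) (f≗g (suc N) ≤-refl)

sumTo-zero : ∀ N → sumTo N (λ _ → 0) ≡ 0
sumTo-zero zero    = refl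
sumTo-zero (suc N) = cong (_+ 0) (sumTo-zero N)


sumTo-*ˡ : ∀ N c f → sumTo N (λ i → c * f i) ≡ c * sumTo N f
sumTo-*ˡ zero    c f = refl
sumTo-*ˡ (suc N) c f = trans (cong (_+ c * f (suc N)) (sumTo-*ˡ N c f)) (sym (*-distribˡ-+ c _ _))


sumTo-shift : ∀ N f → sumTo (suc N) f ≡ f 0 + sumTo N (λ i → f (suc i))
sumTo-shift zero    f = refl
sumTo-shift (suc N) f = trans (cong (_+ f (suc (suc N))) (sumTo-shift N f)) (+-assoc (f 0) _ _)

sumTo-reverse : ∀ N f → sumTo N f ≡ sumTo N (λ i → f (N ∸ i))
sumTo-reverse zero    f = refl
sumTo-reverse (suc N) f = begin
  sumTo (suc N) f                                   ≡⟨ sumTo-shift N f ⟩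
  f 0 + sumTo N (λ i → f (suc i))                   ≡⟨ cong (f 0 +_) (sumTo-reverse N (λ i → f (suc i))) ⟩
  f 0 + sumTo N (λ i → f (suc (N ∸ i)))             ≡⟨ +-comm (f 0) _ ⟩
  sumTo N (λ i → f (suc (N ∸ i))) + f 0
    ≡⟨ cong₂ _+_ (sumTo-cong-≤ N (λ i i≤N → cong f (sym (+-∸-assoc 1 i≤N)))) (cong f (sym (n∸n≡0 N))) ⟩
  sumTo N (λ i → f (suc N ∸ i)) + f (suc N ∸ suc N) ∎

sumTo-truncate : ∀ N M f → M ≤ N → (∀ i → M < i → i ≤ N → f i ≡ 0) → sumTo N f ≡ sumTo M f
sumTo-truncate zero    zero f z≤n _ = refl
sumTo-truncate (suc N) M f M≤1+N f≡0 with m≤n⇒m<n∨m≡n M≤1+N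
... | inj₂ refl = refl
... | inj₁ (s≤s M≤N) = begin
  sumTo N f + f (suc N) ≡⟨ cong (sumTo N f +_) (f≡0 (suc N) (s≤s M≤N) ≤-refl) ⟩
  sumTo N f + 0         ≡⟨ +-identityʳ _ ⟩
  sumTo N f             ≡⟨ sumTo-truncate N M f M≤N (λ i M<i i≤N → f≡0 i M<i (m≤n⇒m≤1+n i≤N)) ⟩
  sumTo M f             ∎

δ-+ : ∀ e x y → δ (x + y) e ≡ sumTo e (λ c → δ x c * δ y (e ∸ c))
δ-+ zero    zero    y = sym (+-identityʳ _)
δ-+ zero    (suc x) y = refl
δ-+ (suc e) zero    y = begin
  δ y (suc e)                                                            ≡⟨ sym (+-identityʳ _) ⟩
  δ y (suc e) + 0                                                        ≡⟨ cong₂ _+_ (sym (*-identityˡ _)) (sym (sumTo-zero e)) ⟩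
  δ 0 0 * δ y (suc e ∸ 0) + sumTo e (λ i → δ 0 (suc i) * δ y (e ∸ i))    ≡⟨ sym (sumTo-shift e _) ⟩
  sumTo (suc e) (λ c → δ 0 c * δ y (suc e ∸ c))                          ∎
δ-+ (suc e) (suc x) y = begin
  δ (x + y) e                                                        ≡⟨ δ-+ e x y ⟩
  0 + sumTo e (λ i → δ (suc x) (suc i) * δ y (suc e ∸ suc i))        ≡⟨ sym (sumTo-shift e _) ⟩
  sumTo (suc e) (λ c → δ (suc x) c * δ y (suc e ∸ c))                ∎

-- Σ of F a b over a + 1 + b = L.
sumSplits : ℕ → (ℕ → ℕ → ℕ) → ℕ
sumSplits zero    F = 0
sumSplits (suc L) F = F 0 L + sumSplits L (λ a b → F (suc a) b)

sumSplits-cong : ∀ L {F G} → (∀ a b → F a b ≡ G a b) → sumSplits L F ≡ sumSplits L G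
sumSplits-cong zero    F≗G = refl
sumSplits-cong (suc L) F≗G = cong₂ _+_ (F≗G 0 L) (sumSplits-cong L (λ a b → F≗G (suc a) b))

sumSplits-zero : ∀ L → sumSplits L (λ _ _ → 0) ≡ 0
sumSplits-zero zero    = refl
sumSplits-zero (suc L) = sumSplits-zero L

sumSplits-+ : ∀ L F G → sumSplits L (λ a b → F a b + G a b) ≡ sumSplits L F + sumSplits L G
sumSplits-+ zero    F G = refl
sumSplits-+ (suc L) F G = trans (cong ((F 0 L + G 0 L) +_) (sumSplits-+ L _ _))
                                (+-interchange (F 0 L) (G 0 L) _ _)

sumSplits-*ˡ : ∀ L c F → sumSplits L (λ a b → c * F a b) ≡ c * sumSplits L F
sumSplits-*ˡ zero    c F = sym (*-zeroʳ c)
sumSplits-*ˡ (suc L) c F = trans (cong (c * F 0 L +_) (sumSplits-*ˡ L c _)) (sym (*-distribˡ-+ c _ _))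

sumSplits≡sumTo : ∀ N F → sumSplits (suc N) F ≡ sumTo N (λ a → F a (N ∸ a))
sumSplits≡sumTo zero    F = +-identityʳ _
sumSplits≡sumTo (suc N) F = trans (cong (F 0 (suc N) +_) (sumSplits≡sumTo N (λ a b → F (suc a) b)))
                                  (sym (sumTo-shift N (λ a → F a (suc N ∸ a))))

length-filter≡sum : ∀ {A : Set} {P : A → Set} (P? : ∀ x → Dec (P x)) xs →
                    length (filter P? xs) ≡ sum (map (λ x → 𝟙 (does (P? x))) xs)
length-filter≡sum P? []       = refl
length-filter≡sum P? (x ∷ xs) with does (P? x)
... | true  = cong suc (length-filter≡sum P? xs)
... | false = length-filter≡sum P? xs

opaque
  sumWords : ℕ → (List Step → ℕ) → ℕ
  sumWords L f = sum (map f (words L))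

  sumWords-zero : ∀ f → sumWords zero f ≡ f []
  sumWords-zero f = +-identityʳ _

  sumWords-suc : ∀ L f → sumWords (suc L) f ≡ sumWords L (λ w → f (U ∷ w)) + sumWords L (λ w → f (D ∷ w))
  sumWords-suc L f = begin
    sum (map f (map (U ∷_) ws ++ map (D ∷_) ws))
      ≡⟨ cong sum (map-++ f (map (U ∷_) ws) _) ⟩
    sum (map f (map (U ∷_) ws) ++ map f (map (D ∷_) ws))
      ≡⟨ sum-++ (map f (map (U ∷_) ws)) _ ⟩
    sum (map f (map (U ∷_) ws)) + sum (map f (map (D ∷_) ws))
      ≡⟨ cong₂ _+_ (cong sum (sym (map-∘ ws))) (cong sum (sym (map-∘ ws))) ⟩
    sum (map (λ w → f (U ∷ w)) ws) + sum (map (λ w → f (D ∷ w)) ws) ∎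
    where
    ws : List (List Step)
    ws = words L

  p≡sumWords : ∀ n m k → p n m k ≡ sumWords (2 * n) (λ w → 𝟙 (does (good? m k w)))
  p≡sumWords n m k = length-filter≡sum (good? m k) (words (2 * n))

sumWords-cong-length : ∀ L {f g} → (∀ w → length w ≡ L → f w ≡ g w) → sumWords L f ≡ sumWords L g
sumWords-cong-length zero    {f} {g} f≗g =
  trans (sumWords-zero f) (trans (f≗g [] refl) (sym (sumWords-zero g)))
sumWords-cong-length (suc L) {f} {g} f≗g = begin
  sumWords (suc L) f                                                ≡⟨ sumWords-suc L f ⟩
  sumWords L (λ w → f (U ∷ w)) + sumWords L (λ w → f (D ∷ w))
    ≡⟨ cong₂ _+_ (sumWords-cong-length L (λ w eq → f≗g (U ∷ w) (cong suc eq)))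
                 (sumWords-cong-length L (λ w eq → f≗g (D ∷ w) (cong suc eq))) ⟩
  sumWords L (λ w → g (U ∷ w)) + sumWords L (λ w → g (D ∷ w))       ≡⟨ sym (sumWords-suc L g) ⟩
  sumWords (suc L) g                                                ∎

sumWords-cong : ∀ L {f g} → (∀ w → f w ≡ g w) → sumWords L f ≡ sumWords L g
sumWords-cong L f≗g = sumWords-cong-length L (λ w _ → f≗g w)

sumWords-0 : ∀ L → sumWords L (λ _ → 0) ≡ 0
sumWords-0 zero    = sumWords-zero _
sumWords-0 (suc L) = trans (sumWords-suc L _) (cong₂ _+_ (sumWords-0 L) (sumWords-0 L))

sumWords-vanish : ∀ L f → (∀ w → length w ≡ L → f w ≡ 0) → sumWords L f ≡ 0
sumWords-vanish L f f≡0 = trans (sumWords-cong-length L f≡0) (sumWords-0 L)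

sumWords-+ : ∀ L f g → sumWords L (λ w → f w + g w) ≡ sumWords L f + sumWords L g
sumWords-+ zero    f g = trans (sumWords-zero _) (sym (cong₂ _+_ (sumWords-zero f) (sumWords-zero g)))
sumWords-+ (suc L) f g = begin
  sumWords (suc L) (λ w → f w + g w)                               ≡⟨ sumWords-suc L _ ⟩
  sumWords L (λ w → f (U ∷ w) + g (U ∷ w)) + sumWords L (λ w → f (D ∷ w) + g (D ∷ w))
    ≡⟨ cong₂ _+_ (sumWords-+ L _ _) (sumWords-+ L _ _) ⟩
  (sumWords L (λ w → f (U ∷ w)) + sumWords L (λ w → g (U ∷ w)))
    + (sumWords L (λ w → f (D ∷ w)) + sumWords L (λ w → g (D ∷ w)))
    ≡⟨ +-interchange (sumWords L (λ w → f (U ∷ w))) _ _ _ ⟩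
  (sumWords L (λ w → f (U ∷ w)) + sumWords L (λ w → f (D ∷ w)))
    + (sumWords L (λ w → g (U ∷ w)) + sumWords L (λ w → g (D ∷ w)))
    ≡⟨ sym (cong₂ _+_ (sumWords-suc L f) (sumWords-suc L g)) ⟩
  sumWords (suc L) f + sumWords (suc L) g                          ∎

sumWords-*ˡ : ∀ L c f → sumWords L (λ w → c * f w) ≡ c * sumWords L f
sumWords-*ˡ zero    c f = trans (sumWords-zero _) (cong (c *_) (sym (sumWords-zero f)))
sumWords-*ˡ (suc L) c f = begin
  sumWords (suc L) (λ w → c * f w)                                  ≡⟨ sumWords-suc L _ ⟩
  sumWords L (λ w → c * f (U ∷ w)) + sumWords L (λ w → c * f (D ∷ w))
    ≡⟨ cong₂ _+_ (sumWords-*ˡ L c _) (sumWords-*ˡ L c _) ⟩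
  c * sumWords L (λ w → f (U ∷ w)) + c * sumWords L (λ w → f (D ∷ w))
    ≡⟨ sym (*-distribˡ-+ c _ _) ⟩
  c * (sumWords L (λ w → f (U ∷ w)) + sumWords L (λ w → f (D ∷ w))) ≡⟨ cong (c *_) (sym (sumWords-suc L f)) ⟩
  c * sumWords (suc L) f                                            ∎

sumWords-*ʳ : ∀ L c f → sumWords L (λ w → f w * c) ≡ sumWords L f * c
sumWords-*ʳ L c f = begin
  sumWords L (λ w → f w * c) ≡⟨ sumWords-cong L (λ w → *-comm (f w) c) ⟩
  sumWords L (λ w → c * f w) ≡⟨ sumWords-*ˡ L c f ⟩
  c * sumWords L f           ≡⟨ *-comm c _ ⟩
  sumWords L f * c           ∎

sumWords-sumTo : ∀ L N (f : List Step → ℕ → ℕ) →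
                 sumWords L (λ w → sumTo N (f w)) ≡ sumTo N (λ i → sumWords L (λ w → f w i))
sumWords-sumTo L zero    f = refl
sumWords-sumTo L (suc N) f =
  trans (sumWords-+ L _ _) (cong (_+ sumWords L (λ w → f w (suc N))) (sumWords-sumTo L N f))

sumWords-sumSplits : ∀ L N (F : List Step → ℕ → ℕ → ℕ) →
                     sumWords L (λ w → sumSplits N (F w)) ≡ sumSplits N (λ a b → sumWords L (λ w → F w a b))
sumWords-sumSplits L zero    F = sumWords-0 L
sumWords-sumSplits L (suc N) F =
  trans (sumWords-+ L _ _) (cong (sumWords L (λ w → F w 0 N) +_) (sumWords-sumSplits L N (λ w a b → F w (suc a) b)))

genPoly : ℕ → (List Step → ℕ) → (List Step → ℕ) → Poly
genPoly L f s k = sumWords L (λ w → f w * δ (s w) k)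

sumWords-*-sumTo : ∀ L e (f : List Step → ℕ) (φ : List Step → ℕ → ℕ) (K : ℕ → ℕ) →
                   sumWords L (λ w → f w * sumTo e (λ c → φ w c * K c))
                   ≡ sumTo e (λ c → sumWords L (λ w → f w * φ w c) * K c)
sumWords-*-sumTo L e f φ K = begin
  sumWords L (λ w → f w * sumTo e (λ c → φ w c * K c))
    ≡⟨ sumWords-cong L (λ w → sym (sumTo-*ˡ e (f w) _)) ⟩
  sumWords L (λ w → sumTo e (λ c → f w * (φ w c * K c)))
    ≡⟨ sumWords-cong L (λ w → sumTo-cong e (λ c → sym (*-assoc (f w) _ _))) ⟩
  sumWords L (λ w → sumTo e (λ c → (f w * φ w c) * K c))
    ≡⟨ sumWords-sumTo L e _ ⟩
  sumTo e (λ c → sumWords L (λ w → (f w * φ w c) * K c))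
    ≡⟨ sumTo-cong e (λ c → sumWords-*ʳ L (K c) _) ⟩
  sumTo e (λ c → sumWords L (λ w → f w * φ w c) * K c) ∎

sumWords-δ-+ : ∀ L e x (g t : List Step → ℕ) →
               sumWords L (λ v → g v * δ (x + t v) e) ≡ sumTo e (λ c → δ x c * genPoly L g t (e ∸ c))
sumWords-δ-+ L e x g t = begin
  sumWords L (λ v → g v * δ (x + t v) e)
    ≡⟨ sumWords-cong L (λ v → cong (g v *_) (δ-+ e x (t v))) ⟩
  sumWords L (λ v → g v * sumTo e (λ c → δ x c * δ (t v) (e ∸ c)))
    ≡⟨ sumWords-cong L (λ v → trans (sym (sumTo-*ˡ e (g v) _))
                                    (sumTo-cong e (λ c → x*[y*z]≡y*[x*z] (g v) (δ x c) (δ (t v) (e ∸ c))))) ⟩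
  sumWords L (λ v → sumTo e (λ c → δ x c * (g v * δ (t v) (e ∸ c))))
    ≡⟨ sumWords-sumTo L e _ ⟩
  sumTo e (λ c → sumWords L (λ v → δ x c * (g v * δ (t v) (e ∸ c))))
    ≡⟨ sumTo-cong e (λ c → sumWords-*ˡ L (δ x c) _) ⟩
  sumTo e (λ c → δ x c * genPoly L g t (e ∸ c)) ∎

genPoly-⊗ : ∀ L₁ L₂ e (f g s t : List Step → ℕ) →
            sumWords L₁ (λ u → f u * sumWords L₂ (λ v → g v * δ (s u + t v) e))
            ≡ (genPoly L₁ f s ⊗ genPoly L₂ g t) e
genPoly-⊗ L₁ L₂ e f g s t = begin
  sumWords L₁ (λ u → f u * sumWords L₂ (λ v → g v * δ (s u + t v) e))
    ≡⟨ sumWords-cong L₁ (λ u → cong (f u *_) (sumWords-δ-+ L₂ e (s u) g t)) ⟩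
  sumWords L₁ (λ u → f u * sumTo e (λ c → δ (s u) c * genPoly L₂ g t (e ∸ c)))
    ≡⟨ sumWords-*-sumTo L₁ e f (λ u c → δ (s u) c) (λ c → genPoly L₂ g t (e ∸ c)) ⟩
  (genPoly L₁ f s ⊗ genPoly L₂ g t) e ∎

genPoly-⊗-⊗ : ∀ L₁ L₂ L₃ e (f g h s t v : List Step → ℕ) →
              sumWords L₁ (λ x → f x * sumWords L₂ (λ y → g y * sumWords L₃ (λ z →
                h z * δ ((s x + t y) + v z) e)))
              ≡ ((genPoly L₁ f s ⊗ genPoly L₂ g t) ⊗ genPoly L₃ h v) e
genPoly-⊗-⊗ L₁ L₂ L₃ e f g h s t v = begin
  sumWords L₁ (λ x → f x * sumWords L₂ (λ y → g y * sumWords L₃ (λ z → h z * δ ((s x + t y) + v z) e)))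
    ≡⟨ sumWords-cong L₁ (λ x → cong (f x *_) (sumWords-cong L₂ (λ y →
         cong (g y *_) (sumWords-δ-+ L₃ e (s x + t y) h v)))) ⟩
  sumWords L₁ (λ x → f x * sumWords L₂ (λ y → g y * sumTo e (λ c → δ (s x + t y) c * H (e ∸ c))))
    ≡⟨ sumWords-cong L₁ (λ x → cong (f x *_) (sumWords-*-sumTo L₂ e g (λ y c → δ (s x + t y) c) (λ c → H (e ∸ c)))) ⟩
  sumWords L₁ (λ x → f x * sumTo e (λ c → sumWords L₂ (λ y → g y * δ (s x + t y) c) * H (e ∸ c)))
    ≡⟨ sumWords-*-sumTo L₁ e f (λ x c → sumWords L₂ (λ y → g y * δ (s x + t y) c)) (λ c → H (e ∸ c)) ⟩
  sumTo e (λ c → sumWords L₁ (λ x → f x * sumWords L₂ (λ y → g y * δ (s x + t y) c)) * H (e ∸ c))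
    ≡⟨ sumTo-cong e (λ c → cong (_* H (e ∸ c)) (genPoly-⊗ L₁ L₂ c f g s t)) ⟩
  ((genPoly L₁ f s ⊗ genPoly L₂ g t) ⊗ H) e ∎
  where
  H : Poly
  H = genPoly L₃ h v

double : ℕ → ℕ
double zero    = zero
double (suc n) = suc (suc (double n))

double≡2* : ∀ n → double n ≡ 2 * n
double≡2* zero    = refl
double≡2* (suc n) = trans (cong (λ x → suc (suc x)) (double≡2* n)) (cong suc (sym (+-suc n (n + 0))))

double≡+ : ∀ n → double n ≡ n + n
double≡+ n = trans (double≡2* n) (cong (n +_) (+-identityʳ n))

double≢1+double : ∀ s c → suc (double s) ≢ double c
double≢1+double zero    zero    ()
double≢1+double (suc s) (suc c) eq = double≢1+double s c (suc-injective (suc-injective eq))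

sumSplits-evenLength : ∀ n F → (∀ a b → F (suc (double a)) b ≡ 0) →
                       sumSplits (double (suc n)) F ≡ sumSplits (suc n) (λ s t → F (double s) (suc (double t)))
sumSplits-evenLength zero    F odd≡0 = cong (F 0 1 +_) (cong (_+ 0) (odd≡0 0 0))
sumSplits-evenLength (suc n) F odd≡0 = cong (F 0 (suc (double (suc n))) +_) (begin
  F 1 (double (suc n)) + sumSplits (double (suc n)) (λ a b → F (suc (suc a)) b)
    ≡⟨ cong₂ _+_ (odd≡0 0 _) refl ⟩
  sumSplits (double (suc n)) (λ a b → F (suc (suc a)) b)
    ≡⟨ sumSplits-evenLength n (λ a b → F (suc (suc a)) b) (λ a b → odd≡0 (suc a) b) ⟩
  sumSplits (suc n) (λ s t → F (double (suc s)) (suc (double t))) ∎)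

sumSplits-oddLength : ∀ t G → (∀ a b → G (suc (double a)) b ≡ 0) →
                      sumSplits (suc (double t)) G ≡ sumSplits (suc t) (λ s u → G (double s) (double u))
sumSplits-oddLength zero    G odd≡0 = refl
sumSplits-oddLength (suc t) G odd≡0 = cong (G 0 (double (suc t)) +_) (begin
  G 1 (suc (double t)) + sumSplits (suc (double t)) (λ a b → G (suc (suc a)) b)
    ≡⟨ cong₂ _+_ (odd≡0 0 _) refl ⟩
  sumSplits (suc (double t)) (λ a b → G (suc (suc a)) b)
    ≡⟨ sumSplits-oddLength t (λ a b → G (suc (suc a)) b) (λ a b → odd≡0 (suc a) b) ⟩
  sumSplits (suc t) (λ s u → G (double (suc s)) (double u)) ∎)

-- (s₁, s₂, s₃) = (m − i, R − j, j + i) parametrises the compositions s₁ + s₂ + s₃ = m + R on which T can be nonzero.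
sumSplits-reindex : ∀ m R (T : ℕ → ℕ → ℕ → ℕ) →
  (∀ s₁ s₂ s₃ → m < s₁ → T s₁ s₂ s₃ ≡ 0) → (∀ s₁ s₂ s₃ → s₃ < m ∸ s₁ → T s₁ s₂ s₃ ≡ 0) →
  sumSplits (suc (m + R)) (λ s₁ t → sumSplits (suc t) (T s₁)) ≡ sumTo m (λ i → sumTo R (λ j → T (m ∸ i) (R ∸ j) (j + i)))
sumSplits-reindex m R T T-s₁ T-s₃ = begin
  sumSplits (suc (m + R)) (λ s₁ t → sumSplits (suc t) (T s₁))
    ≡⟨ sumSplits≡sumTo (m + R) (λ s₁ t → sumSplits (suc t) (T s₁)) ⟩
  sumTo (m + R) (λ s₁ → sumSplits (suc (m + R ∸ s₁)) (T s₁))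
    ≡⟨ sumTo-truncate (m + R) m _ (m≤m+n m R) (λ s₁ m<s₁ _ →
         trans (sumSplits-cong (suc (m + R ∸ s₁)) (λ s₂ s₃ → T-s₁ s₁ s₂ s₃ m<s₁))
               (sumSplits-zero (suc (m + R ∸ s₁)))) ⟩
  sumTo m (λ s₁ → sumSplits (suc (m + R ∸ s₁)) (T s₁))
    ≡⟨ sumTo-reverse m _ ⟩
  sumTo m (λ i → sumSplits (suc (m + R ∸ (m ∸ i))) (T (m ∸ i)))
    ≡⟨ sumTo-cong-≤ m (λ i i≤m → trans (cong (λ L → sumSplits (suc L) (T (m ∸ i))) (remaining i i≤m)) (inner i i≤m)) ⟩
  sumTo m (λ i → sumTo R (λ j → T (m ∸ i) (R ∸ j) (j + i))) ∎
  where
  remaining : ∀ i → i ≤ m → m + R ∸ (m ∸ i) ≡ R + i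
  remaining i i≤m = trans (+-∸-comm R (m∸n≤m m i)) (trans (cong (_+ R) (m∸[m∸n]≡n i≤m)) (+-comm i R))
  s₃<i : ∀ i s₂ → R < s₂ → s₂ ≤ R + i → R + i ∸ s₂ < i
  s₃<i i s₂ R<s₂ s₂≤R+i = +-cancelʳ-< s₂ (R + i ∸ s₂) i
    (subst₂ _<_ (sym (m∸n+n≡m s₂≤R+i)) (+-comm s₂ i) (+-monoˡ-< i R<s₂))
  inner : ∀ i → i ≤ m → sumSplits (suc (R + i)) (T (m ∸ i)) ≡ sumTo R (λ j → T (m ∸ i) (R ∸ j) (j + i))
  inner i i≤m = begin
    sumSplits (suc (R + i)) (T (m ∸ i))                        ≡⟨ sumSplits≡sumTo (R + i) (T (m ∸ i)) ⟩
    sumTo (R + i) (λ s₂ → T (m ∸ i) s₂ (R + i ∸ s₂))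
      ≡⟨ sumTo-truncate (R + i) R _ (m≤m+n R i) (λ s₂ R<s₂ s₂≤R+i →
           T-s₃ (m ∸ i) s₂ _ (subst (R + i ∸ s₂ <_) (sym (m∸[m∸n]≡n i≤m)) (s₃<i i s₂ R<s₂ s₂≤R+i))) ⟩
    sumTo R (λ s₂ → T (m ∸ i) s₂ (R + i ∸ s₂))                 ≡⟨ sumTo-reverse R _ ⟩
    sumTo R (λ j → T (m ∸ i) (R ∸ j) (R + i ∸ (R ∸ j)))
      ≡⟨ sumTo-cong-≤ R (λ j j≤R → cong (T (m ∸ i) (R ∸ j))
           (trans (+-∸-comm i (m∸n≤m R j)) (cong (_+ i) (m∸[m∸n]≡n j≤R)))) ⟩
    sumTo R (λ j → T (m ∸ i) (R ∸ j) (j + i))                  ∎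

reflectStep : Step → Step
reflectStep U = D
reflectStep D = U

reflect : List Step → List Step
reflect []      = []
reflect (s ∷ w) = reflectStep s ∷ reflect w

reflect-++ : ∀ x y → reflect (x ++ y) ≡ reflect x ++ reflect y
reflect-++ []      y = refl
reflect-++ (s ∷ x) y = cong (reflectStep s ∷_) (reflect-++ x y)

sumWords-reflect : ∀ L f → sumWords L (λ w → f (reflect w)) ≡ sumWords L f
sumWords-reflect zero    f = trans (sumWords-zero _) (sym (sumWords-zero _))
sumWords-reflect (suc L) f = begin
  sumWords (suc L) (λ w → f (reflect w))                         ≡⟨ sumWords-suc L _ ⟩
  sumWords L (λ w → f (D ∷ reflect w)) + sumWords L (λ w → f (U ∷ reflect w))
    ≡⟨ cong₂ _+_ (sumWords-reflect L _) (sumWords-reflect L _) ⟩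
  sumWords L (λ w → f (D ∷ w)) + sumWords L (λ w → f (U ∷ w))    ≡⟨ +-comm (sumWords L (λ w → f (D ∷ w))) _ ⟩
  sumWords L (λ w → f (U ∷ w)) + sumWords L (λ w → f (D ∷ w))    ≡⟨ sym (sumWords-suc L f) ⟩
  sumWords (suc L) f                                             ∎

ups : List Step → ℕ
ups []      = 0
ups (U ∷ w) = suc (ups w)
ups (D ∷ w) = ups w

downs : List Step → ℕ
downs []      = 0
downs (U ∷ w) = downs w
downs (D ∷ w) = suc (downs w)

length≡ups+downs : ∀ w → length w ≡ ups w + downs w
length≡ups+downs []      = refl
length≡ups+downs (U ∷ w) = cong suc (length≡ups+downs w)
length≡ups+downs (D ∷ w) = trans (cong suc (length≡ups+downs w)) (sym (+-suc (ups w) (downs w)))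

endHeight-++ : ∀ h x y → endHeight h (x ++ y) ≡ endHeight (endHeight h x) y
endHeight-++ h []      y = refl
endHeight-++ h (U ∷ x) y = endHeight-++ _ x y
endHeight-++ h (D ∷ x) y = endHeight-++ _ x y

underUps-++ : ∀ h x y → underUps h (x ++ y) ≡ underUps h x + underUps (endHeight h x) y
underUps-++ h []      y = refl
underUps-++ h (U ∷ x) y = trans (cong (negInd h +_) (underUps-++ _ x y)) (sym (+-assoc (negInd h) _ _))
underUps-++ h (D ∷ x) y = underUps-++ _ x y

endHeight+downs : ∀ h w → endHeight h w ℤ.+ ℤ.+ downs w ≡ h ℤ.+ ℤ.+ ups w
endHeight+downs h []      = refl
endHeight+downs h (U ∷ w) = trans (endHeight+downs (h ℤ.+ ℤ.1ℤ) w) (ℤ.+-assoc h ℤ.1ℤ (ℤ.+ ups w))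
endHeight+downs h (D ∷ w) = begin
  E ℤ.+ ℤ.+ suc (downs w)              ≡⟨ cong (λ k → E ℤ.+ ℤ.+ k) (+-comm 1 (downs w)) ⟩
  E ℤ.+ (ℤ.+ downs w ℤ.+ ℤ.1ℤ)         ≡⟨ sym (ℤ.+-assoc E (ℤ.+ downs w) ℤ.1ℤ) ⟩
  (E ℤ.+ ℤ.+ downs w) ℤ.+ ℤ.1ℤ         ≡⟨ cong (λ k → k ℤ.+ ℤ.1ℤ) (endHeight+downs (h ℤ.- ℤ.1ℤ) w) ⟩
  (h ℤ.- ℤ.1ℤ ℤ.+ ℤ.+ ups w) ℤ.+ ℤ.1ℤ  ≡⟨ -1+1 h (ℤ.+ ups w) ⟩
  h ℤ.+ ℤ.+ ups w                      ∎
  where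
  -1+1 : ∀ x y → (x ℤ.- ℤ.1ℤ ℤ.+ y) ℤ.+ ℤ.1ℤ ≡ x ℤ.+ y
  -1+1 = ℤ-RingSolver.solve-∀
  E : ℤ
  E = endHeight (h ℤ.- ℤ.1ℤ) w

bridge-ups : ∀ s w → length w ≡ 2 * s → endHeight +0 w ≡ +0 → ups w ≡ s
bridge-ups s w len returns = *-cancelˡ-≡ (ups w) s 2 (begin
  2 * ups w        ≡⟨ cong (ups w +_) (+-identityʳ _) ⟩
  ups w + ups w    ≡⟨ cong (ups w +_) (sym downs≡ups) ⟩
  ups w + downs w  ≡⟨ sym (length≡ups+downs w) ⟩
  length w         ≡⟨ len ⟩
  2 * s            ∎)
  where
  downs≡ups : downs w ≡ ups w
  downs≡ups = ℤ.+-injective (begin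
    ℤ.+ downs w                     ≡⟨ sym (ℤ.+-identityˡ _) ⟩
    +0 ℤ.+ ℤ.+ downs w              ≡⟨ cong (λ k → k ℤ.+ ℤ.+ downs w) (sym returns) ⟩
    endHeight +0 w ℤ.+ ℤ.+ downs w  ≡⟨ endHeight+downs +0 w ⟩
    +0 ℤ.+ ℤ.+ ups w                ≡⟨ ℤ.+-identityˡ _ ⟩
    ℤ.+ ups w                       ∎)

underUps≤ups : ∀ h w → underUps h w ≤ ups w
underUps≤ups h        []      = z≤n
underUps≤ups (ℤ.+ _)  (U ∷ w) = m≤n⇒m≤1+n (underUps≤ups _ w)
underUps≤ups -[1+ _ ] (U ∷ w) = s≤s (underUps≤ups _ w)
underUps≤ups h        (D ∷ w) = underUps≤ups _ w

peaks+peaks≤length : ∀ w → peaks w + peaks w ≤ length w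
peaks+peaks≤length []          = z≤n
peaks+peaks≤length (U ∷ [])    = z≤n
peaks+peaks≤length (U ∷ U ∷ w) = m≤n⇒m≤1+n (peaks+peaks≤length (U ∷ w))
peaks+peaks≤length (U ∷ D ∷ w) =
  s≤s (subst (_≤ suc (length w)) (sym (+-suc (peaks w) (peaks w))) (s≤s (peaks+peaks≤length w)))
peaks+peaks≤length (D ∷ w)     = m≤n⇒m≤1+n (peaks+peaks≤length w)

peaks-++-U : ∀ u v → peaks (u ++ U ∷ v) ≡ peaks u + peaks (U ∷ v)
peaks-++-U []          v = refl
peaks-++-U (U ∷ [])    v = refl
peaks-++-U (U ∷ U ∷ u) v = peaks-++-U (U ∷ u) v
peaks-++-U (U ∷ D ∷ u) v = cong suc (peaks-++-U u v)
peaks-++-U (D ∷ u)     v = peaks-++-U u v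

peaks-++-D : ∀ u v → peaks (u ++ D ∷ v) ≡ peaks (u ++ D ∷ []) + peaks v
peaks-++-D []          v = refl
peaks-++-D (U ∷ [])    v = refl
peaks-++-D (U ∷ U ∷ u) v = peaks-++-D (U ∷ u) v
peaks-++-D (U ∷ D ∷ u) v = cong suc (peaks-++-D u v)
peaks-++-D (D ∷ u)     v = peaks-++-D u v

mutual
  peaks-reflect-D : ∀ a → peaks (reflect a ++ D ∷ []) ≡ peaks (U ∷ a)
  peaks-reflect-D []      = refl
  peaks-reflect-D (U ∷ a) = peaks-reflect-D a
  peaks-reflect-D (D ∷ a) = peaks-arch a

  peaks-arch : ∀ a → peaks (U ∷ reflect a ++ D ∷ []) ≡ suc (peaks a)
  peaks-arch []      = refl
  peaks-arch (U ∷ a) = cong suc (peaks-reflect-D a)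
  peaks-arch (D ∷ a) = peaks-arch a

-- Paths weakly below the axis

-- Started at height −d, the path never rises above the axis (`nonpos`), and moreover ends on it (`nonposTo0`).
nonpos : ℕ → List Step → Bool
nonpos d       []      = true
nonpos d       (D ∷ w) = nonpos (suc d) w
nonpos zero    (U ∷ w) = false
nonpos (suc d) (U ∷ w) = nonpos d w

nonposTo0 : ℕ → List Step → Bool
nonposTo0 d       (D ∷ w) = nonposTo0 (suc d) w
nonposTo0 zero    []      = true
nonposTo0 (suc d) []      = false
nonposTo0 zero    (U ∷ w) = false
nonposTo0 (suc d) (U ∷ w) = nonposTo0 d w

depth : ℕ → ℤ
depth d = ℤ.- (ℤ.+ d)

depth-U : ∀ d → depth (suc d) ℤ.+ ℤ.1ℤ ≡ depth d
depth-U zero    = refl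
depth-U (suc d) = refl

depth-D : ∀ d → depth d ℤ.- ℤ.1ℤ ≡ depth (suc d)
depth-D zero    = refl
depth-D (suc d) = cong (λ x → -[1+ suc x ]) (+-identityʳ d)

height-D : ∀ n → ℤ.+ n ℤ.+ ℤ.1ℤ ≡ +[1+ n ]
height-D n = cong ℤ.+_ (+-comm n 1)

nonposTo0⇒nonpos : ∀ d w → nonposTo0 d w ≡ true → nonpos d w ≡ true
nonposTo0⇒nonpos d       []      _  = refl
nonposTo0⇒nonpos zero    (U ∷ w) ()
nonposTo0⇒nonpos (suc d) (U ∷ w) nw = nonposTo0⇒nonpos d w nw
nonposTo0⇒nonpos d       (D ∷ w) nw = nonposTo0⇒nonpos (suc d) w nw

nonpos-underUps : ∀ d w → nonpos d w ≡ true → underUps (depth d) w ≡ ups w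
nonpos-underUps d       []      _  = refl
nonpos-underUps zero    (U ∷ w) ()
nonpos-underUps (suc d) (U ∷ w) nw = cong suc (trans (cong (λ h → underUps h w) (depth-U d)) (nonpos-underUps d w nw))
nonpos-underUps d       (D ∷ w) nw = trans (cong (λ h → underUps h w) (depth-D d)) (nonpos-underUps (suc d) w nw)

nonposTo0-endHeight : ∀ d w → nonposTo0 d w ≡ true → endHeight (depth d) w ≡ +0
nonposTo0-endHeight zero    []      _  = refl
nonposTo0-endHeight (suc d) []      ()
nonposTo0-endHeight zero    (U ∷ w) ()
nonposTo0-endHeight (suc d) (U ∷ w) nw = trans (cong (λ h → endHeight h w) (depth-U d)) (nonposTo0-endHeight d w nw)
nonposTo0-endHeight d       (D ∷ w) nw = trans (cong (λ h → endHeight h w) (depth-D d)) (nonposTo0-endHeight (suc d) w nw)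

nonpos-endHeight⇒nonposTo0 : ∀ d w → nonpos d w ≡ true → endHeight (depth d) w ≡ +0 → nonposTo0 d w ≡ true
nonpos-endHeight⇒nonposTo0 zero    []      _  _   = refl
nonpos-endHeight⇒nonposTo0 (suc d) []      _  ()
nonpos-endHeight⇒nonposTo0 zero    (U ∷ w) () _
nonpos-endHeight⇒nonposTo0 (suc d) (U ∷ w) nw end =
  nonpos-endHeight⇒nonposTo0 d w nw (trans (cong (λ h → endHeight h w) (sym (depth-U d))) end)
nonpos-endHeight⇒nonposTo0 d       (D ∷ w) nw end =
  nonpos-endHeight⇒nonposTo0 (suc d) w nw (trans (cong (λ h → endHeight h w) (sym (depth-D d))) end)

nonposTo0-length : ∀ d w → nonposTo0 d w ≡ true → length w + d ≡ ups w + ups w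
nonposTo0-length zero    []      _  = refl
nonposTo0-length (suc d) []      ()
nonposTo0-length zero    (U ∷ w) ()
nonposTo0-length (suc d) (U ∷ w) nw = begin
  suc (length w + suc d)      ≡⟨ cong suc (+-suc (length w) d) ⟩
  suc (suc (length w + d))    ≡⟨ cong (λ x → suc (suc x)) (nonposTo0-length d w nw) ⟩
  suc (suc (ups w + ups w))   ≡⟨ cong suc (sym (+-suc (ups w) (ups w))) ⟩
  suc (ups w + suc (ups w))   ∎
nonposTo0-length d       (D ∷ w) nw = trans (sym (+-suc (length w) d)) (nonposTo0-length (suc d) w nw)

nonpos-underUps<ups : ∀ d w → nonpos d w ≡ false → underUps (depth d) w < ups w
nonpos-underUps<ups d       []      ()
nonpos-underUps<ups d       (D ∷ w) nw =
  subst (λ h → underUps h w < ups w) (sym (depth-D d)) (nonpos-underUps<ups (suc d) w nw)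
nonpos-underUps<ups zero    (U ∷ w) _  = s≤s (underUps≤ups _ w)
nonpos-underUps<ups (suc d) (U ∷ w) nw =
  s≤s (subst (λ h → underUps h w < ups w) (sym (depth-U d)) (nonpos-underUps<ups d w nw))

reflect-nonpos-underUps : ∀ d a → nonpos d a ≡ true → underUps +[1+ d ] (reflect a) ≡ 0
reflect-nonpos-underUps d       []      _  = refl
reflect-nonpos-underUps zero    (U ∷ a) ()
reflect-nonpos-underUps (suc d) (U ∷ a) na = reflect-nonpos-underUps d a na
reflect-nonpos-underUps d       (D ∷ a) na =
  trans (cong (λ h → underUps h (reflect a)) (height-D (suc d))) (reflect-nonpos-underUps (suc d) a na)

reflect-nonposTo0-endHeight : ∀ d a → nonposTo0 d a ≡ true → endHeight +[1+ d ] (reflect a) ≡ ℤ.1ℤ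
reflect-nonposTo0-endHeight zero    []      _  = refl
reflect-nonposTo0-endHeight (suc d) []      ()
reflect-nonposTo0-endHeight zero    (U ∷ a) ()
reflect-nonposTo0-endHeight (suc d) (U ∷ a) na = reflect-nonposTo0-endHeight d a na
reflect-nonposTo0-endHeight d       (D ∷ a) na =
  trans (cong (λ h → endHeight h (reflect a)) (height-D (suc d))) (reflect-nonposTo0-endHeight (suc d) a na)

reflect-nonpos-endHeight : ∀ d a → nonpos d a ≡ true → ∃ λ k → endHeight +[1+ d ] (reflect a) ≡ +[1+ k ]
reflect-nonpos-endHeight d       []      _  = d , refl
reflect-nonpos-endHeight zero    (U ∷ a) ()
reflect-nonpos-endHeight (suc d) (U ∷ a) na = reflect-nonpos-endHeight d a na
reflect-nonpos-endHeight d       (D ∷ a) na with reflect-nonpos-endHeight (suc d) a na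
... | k , end = k , trans (cong (λ h → endHeight h (reflect a)) (height-D (suc d))) end

firstUpSplits : ℕ → ℕ → (List Step → ℕ) → ℕ
firstUpSplits d L f =
  sumSplits L (λ l₁ l₂ → sumWords l₁ (λ u → 𝟙 (nonposTo0 d u) * sumWords l₂ (λ v → f (u ++ U ∷ v))))

firstUpSplits-zero : ∀ L f →
  firstUpSplits 0 (suc L) f ≡ sumWords L (λ v → f (U ∷ v)) + firstUpSplits 1 L (λ w → f (D ∷ w))
firstUpSplits-zero L f = cong₂ _+_
  (trans (sumWords-zero _) (*-identityˡ _))
  (sumSplits-cong L (λ a b → trans (sumWords-suc a _) (trans (cong₂ _+_ (sumWords-0 a) refl) (+-identityˡ _))))

firstUpSplits-suc : ∀ d L f →
  firstUpSplits (suc d) (suc L) f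
  ≡ firstUpSplits d L (λ w → f (U ∷ w)) + firstUpSplits (suc (suc d)) L (λ w → f (D ∷ w))
firstUpSplits-suc d L f = begin
  firstUpSplits (suc d) (suc L) f
    ≡⟨ cong₂ _+_ (sumWords-zero _) refl ⟩
  0 + sumSplits L (λ a b → sumWords (suc a) (λ u → 𝟙 (nonposTo0 (suc d) u) * sumWords b (λ v → f (u ++ U ∷ v))))
    ≡⟨ sumSplits-cong L (λ a b → sumWords-suc a _) ⟩
  sumSplits L (λ a b → sumWords a (λ u → 𝟙 (nonposTo0 d u) * sumWords b (λ v → f (U ∷ u ++ U ∷ v)))
                     + sumWords a (λ u → 𝟙 (nonposTo0 (suc (suc d)) u) * sumWords b (λ v → f (D ∷ u ++ U ∷ v))))
    ≡⟨ sumSplits-+ L _ _ ⟩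
  firstUpSplits d L (λ w → f (U ∷ w)) + firstUpSplits (suc (suc d)) L (λ w → f (D ∷ w)) ∎

-- A path either stays weakly below the axis, or splits uniquely at its first up step from the axis.
sumWords-firstUp : ∀ L d f →
  sumWords L f ≡ sumWords L (λ w → 𝟙 (nonpos d w) * f w) + firstUpSplits d L f
sumWords-firstUp zero    d f = begin
  sumWords zero f                                         ≡⟨ sumWords-zero f ⟩
  f []                                                    ≡⟨ sym (trans (+-identityʳ _) (*-identityˡ _)) ⟩
  1 * f [] + 0                                            ≡⟨ cong (_+ 0) (sym (sumWords-zero _)) ⟩
  sumWords zero (λ w → 𝟙 (nonpos d w) * f w) + 0          ∎
sumWords-firstUp (suc L) zero    f = begin
  sumWords (suc L) f                                      ≡⟨ sumWords-suc L f ⟩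
  Up + sumWords L (λ w → f (D ∷ w))                       ≡⟨ cong (Up +_) (sumWords-firstUp L 1 (λ w → f (D ∷ w))) ⟩
  Up + (Stay + Split)                                     ≡⟨ +-interchange 0 Up Stay Split ⟩
  (0 + Stay) + (Up + Split)
    ≡⟨ cong₂ _+_ (cong (_+ Stay) (sym (sumWords-0 L))) (sym (firstUpSplits-zero L f)) ⟩
  (sumWords L (λ _ → 0) + Stay) + firstUpSplits 0 (suc L) f
    ≡⟨ cong (_+ firstUpSplits 0 (suc L) f) (sym (sumWords-suc L _)) ⟩
  sumWords (suc L) (λ w → 𝟙 (nonpos 0 w) * f w) + firstUpSplits 0 (suc L) f ∎
  where
  Up Stay Split : ℕ
  Up    = sumWords L (λ w → f (U ∷ w))
  Stay  = sumWords L (λ w → 𝟙 (nonpos 1 w) * f (D ∷ w))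
  Split = firstUpSplits 1 L (λ w → f (D ∷ w))
sumWords-firstUp (suc L) (suc d) f = begin
  sumWords (suc L) f                                      ≡⟨ sumWords-suc L f ⟩
  sumWords L (λ w → f (U ∷ w)) + sumWords L (λ w → f (D ∷ w))
    ≡⟨ cong₂ _+_ (sumWords-firstUp L d (λ w → f (U ∷ w))) (sumWords-firstUp L (suc (suc d)) (λ w → f (D ∷ w))) ⟩
  (StayU + SplitU) + (StayD + SplitD)                     ≡⟨ +-interchange StayU SplitU StayD SplitD ⟩
  (StayU + StayD) + (SplitU + SplitD)
    ≡⟨ cong₂ _+_ (sym (sumWords-suc L _)) (sym (firstUpSplits-suc d L f)) ⟩
  sumWords (suc L) (λ w → 𝟙 (nonpos (suc d) w) * f w) + firstUpSplits (suc d) (suc L) f ∎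
  where
  StayU SplitU StayD SplitD : ℕ
  StayU  = sumWords L (λ w → 𝟙 (nonpos d w) * f (U ∷ w))
  SplitU = firstUpSplits d L (λ w → f (U ∷ w))
  StayD  = sumWords L (λ w → 𝟙 (nonpos (suc (suc d)) w) * f (D ∷ w))
  SplitD = firstUpSplits (suc (suc d)) L (λ w → f (D ∷ w))

returnsToAxis : List Step → ℕ
returnsToAxis w = 𝟙 (does (endHeight +0 w ℤ.≟ +0))

flawedWeight : ℕ → List Step → ℕ
flawedWeight m w = returnsToAxis w * δ (underUps +0 w) m

𝟙-∧ : ∀ a b → 𝟙 (a ∧ b) ≡ 𝟙 a * 𝟙 b
𝟙-∧ true  b = sym (+-identityʳ _)
𝟙-∧ false b = refl

good-indicator : ∀ m k w → 𝟙 (does (good? m k w)) ≡ flawedWeight m w * δ (peaks w) k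
good-indicator m k w = begin
  𝟙 (does (good? m k w))                                   ≡⟨ 𝟙-∧ (does (endHeight +0 w ℤ.≟ +0)) _ ⟩
  𝟙 (does (endHeight +0 w ℤ.≟ +0)) * 𝟙 (does (underUps +0 w ≟ m) ∧ does (peaks w ≟ k))
    ≡⟨ cong (𝟙 (does (endHeight +0 w ℤ.≟ +0)) *_) (𝟙-∧ (does (underUps +0 w ≟ m)) _) ⟩
  𝟙 (does (endHeight +0 w ℤ.≟ +0)) * (δ (underUps +0 w) m * δ (peaks w) k)
    ≡⟨ sym (*-assoc (returnsToAxis w) _ _) ⟩
  flawedWeight m w * δ (peaks w) k                         ∎

flawedWeight-vanish : ∀ m w → (endHeight +0 w ≡ +0 → underUps +0 w ≡ m → ⊥) → flawedWeight m w ≡ 0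
flawedWeight-vanish m w notFlawed with endHeight +0 w ℤ.≟ +0
... | no  _       = refl
... | yes returns = trans (+-identityʳ _) (δ-≢ (notFlawed returns))

flawedWeight-too-many : ∀ s m w → length w ≡ 2 * s → s < m → flawedWeight m w ≡ 0
flawedWeight-too-many s m w len s<m = flawedWeight-vanish m w λ returns flaws →
  <-irrefl flaws (≤-<-trans (subst (underUps +0 w ≤_) (bridge-ups s w len returns) (underUps≤ups +0 w)) s<m)

negDyck : List Step → ℕ
negDyck u = 𝟙 (nonposTo0 0 u)

flawedWeight-negDyck : ∀ s w → length w ≡ 2 * s → flawedWeight s w ≡ negDyck w
flawedWeight-negDyck s w len with nonposTo0 0 w in negDyck
... | true = begin
  flawedWeight s w                                        ≡⟨ cong₂ (λ x y → 𝟙 (does (x ℤ.≟ +0)) * δ y s) returns flaws ⟩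
  1 * δ s s                                               ≡⟨ cong (1 *_) (δ-refl s) ⟩
  1                                                       ∎
  where
  returns = nonposTo0-endHeight 0 w negDyck
  flaws   = trans (nonpos-underUps 0 w (nonposTo0⇒nonpos 0 w negDyck)) (bridge-ups s w len returns)
... | false = flawedWeight-vanish s w λ returns flaws → stays returns flaws
  where
  stays : endHeight +0 w ≡ +0 → underUps +0 w ≡ s → ⊥
  stays returns flaws with nonpos 0 w in nw
  ... | true  = case trans (sym (nonpos-endHeight⇒nonposTo0 0 w nw returns)) negDyck of λ ()
  ... | false = <-irrefl (trans flaws (sym (bridge-ups s w len returns))) (nonpos-underUps<ups 0 w nw)

p≡genPoly : ∀ n m k → p n m k ≡ genPoly (2 * n) (flawedWeight m) peaks k
p≡genPoly n m k = trans (p≡sumWords n m k) (sumWords-cong (2 * n) (good-indicator m k))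

p-too-many-peaks : ∀ n m k → n < k → p n m k ≡ 0
p-too-many-peaks n m k n<k = trans (p≡genPoly n m k) (sumWords-vanish (2 * n) _ λ w len →
  trans (cong (flawedWeight m w *_) (δ-≢ (<⇒≢ (peaks<k w len)))) (*-zeroʳ (flawedWeight m w)))
  where
  peaks<k : ∀ w → length w ≡ 2 * n → peaks w < k
  peaks<k w len = ≤-<-trans (*-cancelˡ-≤ 2 twicePeaks≤2n) n<k
    where
    twicePeaks≤2n : 2 * peaks w ≤ 2 * n
    twicePeaks≤2n = subst₂ _≤_ (cong (λ x → peaks w + x) (sym (+-identityʳ _))) len (peaks+peaks≤length w)

P≡genPoly : ∀ n m k → P n m k ≡ genPoly (2 * n) (flawedWeight m) peaks k
P≡genPoly n m k with k ≤? n
... | yes _   = p≡genPoly n m k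
... | no  k≰n = trans (sym (p-too-many-peaks n m k (≰⇒> k≰n))) (p≡genPoly n m k)

-- Splitting off the first excursion above the axis

splice : List Step → List Step → List Step → List Step
splice u a b = u ++ U ∷ reflect a ++ D ∷ b

endHeight-splice : ∀ u a b → nonposTo0 0 u ≡ true → nonposTo0 0 a ≡ true →
                   endHeight +0 (splice u a b) ≡ endHeight +0 b
endHeight-splice u a b u↓ a↓ = begin
  endHeight +0 (u ++ U ∷ reflect a ++ D ∷ b)  ≡⟨ endHeight-++ +0 u _ ⟩
  endHeight (endHeight +0 u) (U ∷ reflect a ++ D ∷ b)
    ≡⟨ cong (λ h → endHeight h (U ∷ reflect a ++ D ∷ b)) (nonposTo0-endHeight 0 u u↓) ⟩
  endHeight ℤ.1ℤ (reflect a ++ D ∷ b)         ≡⟨ endHeight-++ ℤ.1ℤ (reflect a) _ ⟩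
  endHeight (endHeight ℤ.1ℤ (reflect a)) (D ∷ b)
    ≡⟨ cong (λ h → endHeight h (D ∷ b)) (reflect-nonposTo0-endHeight 0 a a↓) ⟩
  endHeight +0 b                              ∎

underUps-splice : ∀ u a b → nonposTo0 0 u ≡ true → nonposTo0 0 a ≡ true →
                  underUps +0 (splice u a b) ≡ ups u + underUps +0 b
underUps-splice u a b u↓ a↓ = begin
  underUps +0 (u ++ U ∷ reflect a ++ D ∷ b)   ≡⟨ underUps-++ +0 u _ ⟩
  underUps +0 u + underUps (endHeight +0 u) (U ∷ reflect a ++ D ∷ b)
    ≡⟨ cong₂ _+_ (nonpos-underUps 0 u (nonposTo0⇒nonpos 0 u u↓))
                 (cong (λ h → underUps h (U ∷ reflect a ++ D ∷ b)) (nonposTo0-endHeight 0 u u↓)) ⟩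
  ups u + underUps ℤ.1ℤ (reflect a ++ D ∷ b)  ≡⟨ cong (λ x → ups u + x) (underUps-++ ℤ.1ℤ (reflect a) _) ⟩
  ups u + (underUps ℤ.1ℤ (reflect a) + underUps (endHeight ℤ.1ℤ (reflect a)) (D ∷ b))
    ≡⟨ cong (λ x → ups u + x) (cong₂ _+_ (reflect-nonpos-underUps 0 a (nonposTo0⇒nonpos 0 a a↓))
                                        (cong (λ h → underUps h (D ∷ b)) (reflect-nonposTo0-endHeight 0 a a↓))) ⟩
  ups u + underUps +0 b                       ∎

peaks-splice : ∀ u a b → peaks (splice u a b) ≡ suc ((peaks u + peaks a) + peaks b)
peaks-splice u a b = begin
  peaks (u ++ U ∷ reflect a ++ D ∷ b)                    ≡⟨ peaks-++-U u _ ⟩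
  peaks u + peaks ((U ∷ reflect a) ++ D ∷ b)             ≡⟨ cong (peaks u +_) (peaks-++-D (U ∷ reflect a) b) ⟩
  peaks u + (peaks (U ∷ reflect a ++ D ∷ []) + peaks b)  ≡⟨ cong (λ x → peaks u + (x + peaks b)) (peaks-arch a) ⟩
  peaks u + suc (peaks a + peaks b)                      ≡⟨ +-suc (peaks u) (peaks a + peaks b) ⟩
  suc (peaks u + (peaks a + peaks b))                    ≡⟨ cong suc (+-assoc (peaks u) (peaks a) (peaks b)) ⟨
  suc ((peaks u + peaks a) + peaks b)                    ∎

firstUp-reflect-nonpos-endHeight : ∀ u v → nonposTo0 0 u ≡ true → nonpos 0 v ≡ true →
                                   endHeight +0 (u ++ U ∷ reflect v) ≢ +0
firstUp-reflect-nonpos-endHeight u v u↓ v↓ returns with reflect-nonpos-endHeight 0 v v↓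
... | k , end with trans (sym end) (begin
  endHeight ℤ.1ℤ (reflect v)                  ≡⟨ cong (λ h → endHeight h (U ∷ reflect v)) (nonposTo0-endHeight 0 u u↓) ⟨
  endHeight (endHeight +0 u) (U ∷ reflect v)  ≡⟨ endHeight-++ +0 u _ ⟨
  endHeight +0 (u ++ U ∷ reflect v)           ≡⟨ returns ⟩
  +0                                          ∎)
... | ()

excursionSplits : List Step → ℕ → (List Step → ℕ) → ℕ
excursionSplits u l h =
  sumSplits l (λ l₁ l₂ → sumWords l₁ (λ a → negDyck a * sumWords l₂ (λ b → h (splice u a b))))

-- After the first up step from the axis, the path must come back down: reflect it and split at its first return.
sumWords-afterFirstUp : ∀ u l (h : List Step → ℕ) → nonposTo0 0 u ≡ true → (∀ w → endHeight +0 w ≢ +0 → h w ≡ 0) →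
                        sumWords l (λ v → h (u ++ U ∷ v)) ≡ excursionSplits u l h
sumWords-afterFirstUp u l h u↓ h-returns = begin
  sumWords l (λ v → h (u ++ U ∷ v))                       ≡⟨ sumWords-reflect l _ ⟨
  sumWords l (λ v → h (u ++ U ∷ reflect v))               ≡⟨ sumWords-firstUp l 0 _ ⟩
  sumWords l (λ v → 𝟙 (nonpos 0 v) * h (u ++ U ∷ reflect v)) + firstUpSplits 0 l (λ v → h (u ++ U ∷ reflect v))
    ≡⟨ cong₂ _+_ (sumWords-vanish l _ (λ v _ → 𝟙-true-*-0 (nonpos 0 v) (stays v)))
                 (sumSplits-cong l (λ l₁ l₂ → sumWords-cong l₁ (λ a → cong (negDyck a *_) (returns a l₂)))) ⟩
  0 + excursionSplits u l h                               ∎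
  where
  stays : ∀ v → nonpos 0 v ≡ true → h (u ++ U ∷ reflect v) ≡ 0
  stays v v↓ = h-returns _ (firstUp-reflect-nonpos-endHeight u v u↓ v↓)
  returns : ∀ a l₂ → sumWords l₂ (λ v → h (u ++ U ∷ reflect (a ++ U ∷ v))) ≡ sumWords l₂ (λ b → h (splice u a b))
  returns a l₂ = trans (sumWords-cong l₂ (λ v → cong (λ x → h (u ++ U ∷ x)) (reflect-++ a (U ∷ v))))
                       (sumWords-reflect l₂ (λ b → h (splice u a b)))

sumWords-flawed-decomp : ∀ n m (g : List Step → ℕ) → m ≢ n →
  sumWords (2 * n) (λ w → flawedWeight m w * g w)
  ≡ sumSplits (2 * n) (λ l₁ l₂ → sumWords l₁ (λ u → negDyck u *
      excursionSplits u l₂ (λ w → flawedWeight m w * g w)))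
sumWords-flawed-decomp n m g m≢n = begin
  sumWords (2 * n) h                                      ≡⟨ sumWords-firstUp (2 * n) 0 h ⟩
  sumWords (2 * n) (λ w → 𝟙 (nonpos 0 w) * h w) + firstUpSplits 0 (2 * n) h
    ≡⟨ cong₂ _+_ (sumWords-vanish (2 * n) (λ w → 𝟙 (nonpos 0 w) * h w) (λ w len → 𝟙-true-*-0 (nonpos 0 w) (stays w len)))
                 (sumSplits-cong (2 * n) (λ l₁ l₂ → sumWords-cong l₁ (λ u →
                    𝟙-true-* (nonposTo0 0 u) (λ u↓ → sumWords-afterFirstUp u l₂ h u↓ h-returns)))) ⟩
  0 + sumSplits (2 * n) (λ l₁ l₂ → sumWords l₁ (λ u → negDyck u * excursionSplits u l₂ h)) ∎
  where
  h : List Step → ℕ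
  h w = flawedWeight m w * g w
  h-returns : ∀ w → endHeight +0 w ≢ +0 → h w ≡ 0
  h-returns w ¬returns = cong (λ x → x * g w) (flawedWeight-vanish m w (λ returns _ → ¬returns returns))
  stays : ∀ w → length w ≡ 2 * n → nonpos 0 w ≡ true → h w ≡ 0
  stays w len w↓ = cong (λ x → x * g w) (flawedWeight-vanish m w λ returns flaws →
    m≢n (trans (sym flaws) (trans (nonpos-underUps 0 w w↓) (bridge-ups n w len returns))))

nonposTo0-ups : ∀ s u → length u ≡ double s → nonposTo0 0 u ≡ true → ups u ≡ s
nonposTo0-ups s u len u↓ = *-cancelˡ-≡ (ups u) s 2 (begin
  2 * ups u           ≡⟨ double≡2* (ups u) ⟨
  double (ups u)      ≡⟨ double≡+ (ups u) ⟩
  ups u + ups u       ≡⟨ nonposTo0-length 0 u u↓ ⟨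
  length u + 0        ≡⟨ +-identityʳ _ ⟩
  length u            ≡⟨ len ⟩
  double s            ≡⟨ double≡2* s ⟩
  2 * s               ∎)

sumWords-negDyck-odd : ∀ s (f : List Step → ℕ) → sumWords (suc (double s)) (λ u → negDyck u * f u) ≡ 0
sumWords-negDyck-odd s f = sumWords-vanish (suc (double s)) _ λ u len → 𝟙-true-*-0 (nonposTo0 0 u) λ u↓ →
  ⊥-elim (double≢1+double s (ups u) (begin
    suc (double s)    ≡⟨ len ⟨
    length u          ≡⟨ +-identityʳ _ ⟨
    length u + 0      ≡⟨ nonposTo0-length 0 u u↓ ⟩
    ups u + ups u     ≡⟨ double≡+ (ups u) ⟨
    double (ups u)    ∎))

peakWeight : ℕ → ℕ → List Step → ℕ
peakWeight m k w = flawedWeight m w * δ (peaks w) k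

flawedWeight-splice : ∀ s m u a b → ups u ≡ s → nonposTo0 0 u ≡ true → nonposTo0 0 a ≡ true →
                      flawedWeight m (splice u a b) ≡ returnsToAxis b * δ (s + underUps +0 b) m
flawedWeight-splice s m u a b ups≡s u↓ a↓ = cong₂ _*_
  (cong (λ h → 𝟙 (does (h ℤ.≟ +0))) (endHeight-splice u a b u↓ a↓))
  (cong (λ x → δ x m) (trans (underUps-splice u a b u↓ a↓) (cong (_+ underUps +0 b) ups≡s)))

flawedWeight-splice-≤ : ∀ s m u a b → ups u ≡ s → s ≤ m → nonposTo0 0 u ≡ true → nonposTo0 0 a ≡ true →
                        flawedWeight m (splice u a b) ≡ flawedWeight (m ∸ s) b
flawedWeight-splice-≤ s m u a b ups≡s s≤m u↓ a↓ =
  trans (flawedWeight-splice s m u a b ups≡s u↓ a↓) (cong (returnsToAxis b *_) (δ-+ˡ s (underUps +0 b) m s≤m))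

flawedWeight-splice-> : ∀ s m u a b → ups u ≡ s → m < s → nonposTo0 0 u ≡ true → nonposTo0 0 a ≡ true →
                        flawedWeight m (splice u a b) ≡ 0
flawedWeight-splice-> s m u a b ups≡s m<s u↓ a↓ = begin
  flawedWeight m (splice u a b)              ≡⟨ flawedWeight-splice s m u a b ups≡s u↓ a↓ ⟩
  returnsToAxis b * δ (s + underUps +0 b) m  ≡⟨ cong (returnsToAxis b *_) (δ-+ˡ-> s (underUps +0 b) m m<s) ⟩
  returnsToAxis b * 0                        ≡⟨ *-zeroʳ (returnsToAxis b) ⟩
  0                                          ∎

tripleSum : ℕ → ℕ → ℕ → (List Step → List Step → List Step → ℕ) → ℕ
tripleSum s₁ s₂ s₃ H =
  sumWords (double s₁) (λ u → negDyck u * sumWords (double s₂) (λ a → negDyck a * sumWords (double s₃) (λ b → H u a b)))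

tripleSum-cong : ∀ s₁ s₂ s₃ {H H′} →
  (∀ u a b → ups u ≡ s₁ → length b ≡ double s₃ → nonposTo0 0 u ≡ true → nonposTo0 0 a ≡ true →
   H u a b ≡ H′ u a b) →
  tripleSum s₁ s₂ s₃ H ≡ tripleSum s₁ s₂ s₃ H′
tripleSum-cong s₁ s₂ s₃ H≗H′ = sumWords-cong-length (double s₁) λ u len → 𝟙-true-* (nonposTo0 0 u) λ u↓ →
  sumWords-cong (double s₂) λ a → 𝟙-true-* (nonposTo0 0 a) λ a↓ →
  sumWords-cong-length (double s₃) λ b len′ → H≗H′ u a b (nonposTo0-ups s₁ u len u↓) len′ u↓ a↓

tripleSum-0 : ∀ s₁ s₂ s₃ → tripleSum s₁ s₂ s₃ (λ _ _ _ → 0) ≡ 0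
tripleSum-0 s₁ s₂ s₃ = sumWords-vanish (double s₁) _ λ u _ → begin
  negDyck u * sumWords (double s₂) (λ a → negDyck a * sumWords (double s₃) (λ _ → 0))
    ≡⟨ cong (negDyck u *_) (sumWords-vanish (double s₂) _ λ a _ →
         trans (cong (negDyck a *_) (sumWords-0 (double s₃))) (*-zeroʳ (negDyck a))) ⟩
  negDyck u * 0                                        ≡⟨ *-zeroʳ (negDyck u) ⟩
  0                                                    ∎

spliceSum : ℕ → ℕ → ℕ → ℕ → ℕ → ℕ
spliceSum m k s₁ s₂ s₃ = tripleSum s₁ s₂ s₃ (λ u a b → peakWeight m k (splice u a b))

spliceSum-vanish : ∀ m k s₁ s₂ s₃ → (∀ u a b → ups u ≡ s₁ → length b ≡ double s₃ →
                   nonposTo0 0 u ≡ true → nonposTo0 0 a ≡ true → flawedWeight m (splice u a b) ≡ 0) →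
                   spliceSum m k s₁ s₂ s₃ ≡ 0
spliceSum-vanish m k s₁ s₂ s₃ fw≡0 = trans
  (tripleSum-cong s₁ s₂ s₃ λ u a b ups≡ len u↓ a↓ → cong (_* δ (peaks (splice u a b)) k) (fw≡0 u a b ups≡ len u↓ a↓))
  (tripleSum-0 s₁ s₂ s₃)

spliceSum-too-many : ∀ m k s₁ s₂ s₃ → m < s₁ → spliceSum m k s₁ s₂ s₃ ≡ 0
spliceSum-too-many m k s₁ s₂ s₃ m<s₁ =
  spliceSum-vanish m k s₁ s₂ s₃ λ u a b ups≡ _ u↓ a↓ → flawedWeight-splice-> s₁ m u a b ups≡ m<s₁ u↓ a↓

spliceSum-short-tail : ∀ m k s₁ s₂ s₃ → s₃ < m ∸ s₁ → spliceSum m k s₁ s₂ s₃ ≡ 0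
spliceSum-short-tail m k s₁ s₂ s₃ s₃<m∸s₁ with s₁ ≤? m
... | no  s₁≰m = spliceSum-too-many m k s₁ s₂ s₃ (≰⇒> s₁≰m)
... | yes s₁≤m = spliceSum-vanish m k s₁ s₂ s₃ λ u a b ups≡ len u↓ a↓ →
  trans (flawedWeight-splice-≤ s₁ m u a b ups≡ s₁≤m u↓ a↓)
        (flawedWeight-too-many s₃ (m ∸ s₁) b (trans len (double≡2* s₃)) s₃<m∸s₁)

spliceSum-zero : ∀ m s₁ s₂ s₃ → spliceSum m 0 s₁ s₂ s₃ ≡ 0
spliceSum-zero m s₁ s₂ s₃ = trans
  (tripleSum-cong s₁ s₂ s₃ λ u a b _ _ _ _ → begin
    flawedWeight m (splice u a b) * δ (peaks (splice u a b)) 0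
      ≡⟨ cong (λ x → flawedWeight m (splice u a b) * δ x 0) (peaks-splice u a b) ⟩
    flawedWeight m (splice u a b) * 0    ≡⟨ *-zeroʳ (flawedWeight m (splice u a b)) ⟩
    0                                    ∎)
  (tripleSum-0 s₁ s₂ s₃)

spliceSum-⊗ : ∀ m e s₁ s₂ s₃ → s₁ ≤ m →
  spliceSum m (suc e) s₁ s₂ s₃
  ≡ ((genPoly (double s₁) negDyck peaks ⊗ genPoly (double s₂) negDyck peaks)
      ⊗ genPoly (double s₃) (flawedWeight (m ∸ s₁)) peaks) e
spliceSum-⊗ m e s₁ s₂ s₃ s₁≤m = trans
  (tripleSum-cong s₁ s₂ s₃ λ u a b ups≡ _ u↓ a↓ → cong₂ _*_
    (flawedWeight-splice-≤ s₁ m u a b ups≡ s₁≤m u↓ a↓)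
    (cong (λ x → δ x (suc e)) (peaks-splice u a b)))
  (genPoly-⊗-⊗ (double s₁) (double s₂) (double s₃) e negDyck negDyck (flawedWeight (m ∸ s₁)) peaks peaks peaks)

genPoly-spliceSums : ∀ m r′ k →
  genPoly (2 * (m + suc r′)) (flawedWeight m) peaks k
  ≡ sumSplits (suc (m + r′)) (λ s₁ t → sumSplits (suc t) (spliceSum m k s₁))
genPoly-spliceSums m r′ k = begin
  sumWords (2 * n) h
    ≡⟨ sumWords-flawed-decomp n m (λ w → δ (peaks w) k) (≢-sym (m+1+n≢m m)) ⟩
  sumSplits (2 * n) F
    ≡⟨ cong (λ L → sumSplits L F) (trans (sym (double≡2* n)) (cong double (+-suc m r′))) ⟩
  sumSplits (double (suc (m + r′))) F
    ≡⟨ sumSplits-evenLength (m + r′) F (λ s l → sumWords-negDyck-odd s (λ u → excursionSplits u l h)) ⟩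
  sumSplits (suc (m + r′)) (λ s₁ t → F (double s₁) (suc (double t)))
    ≡⟨ sumSplits-cong (suc (m + r′)) (λ s₁ t → inner s₁ t) ⟩
  sumSplits (suc (m + r′)) (λ s₁ t → sumSplits (suc t) (spliceSum m k s₁)) ∎
  where
  n : ℕ
  n = m + suc r′
  h : List Step → ℕ
  h = peakWeight m k
  F : ℕ → ℕ → ℕ
  F l₁ l₂ = sumWords l₁ (λ u → negDyck u * excursionSplits u l₂ h)
  inner : ∀ s₁ t → F (double s₁) (suc (double t)) ≡ sumSplits (suc t) (spliceSum m k s₁)
  inner s₁ t = begin
    sumWords (double s₁) (λ u → negDyck u * excursionSplits u (suc (double t)) h)
      ≡⟨ sumWords-cong (double s₁) (λ u → cong (negDyck u *_) (sumSplits-oddLength t (A u) (λ s l →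
           sumWords-negDyck-odd s (λ a → sumWords l (λ b → h (splice u a b)))))) ⟩
    sumWords (double s₁) (λ u → negDyck u * sumSplits (suc t) (λ s₂ s₃ → A u (double s₂) (double s₃)))
      ≡⟨ sumWords-cong (double s₁) (λ u → sym (sumSplits-*ˡ (suc t) (negDyck u) (λ s₂ s₃ → A u (double s₂) (double s₃)))) ⟩
    sumWords (double s₁) (λ u → sumSplits (suc t) (λ s₂ s₃ → negDyck u * A u (double s₂) (double s₃)))
      ≡⟨ sumWords-sumSplits (double s₁) (suc t) (λ u s₂ s₃ → negDyck u * A u (double s₂) (double s₃)) ⟩
    sumSplits (suc t) (spliceSum m k s₁) ∎
    where
    A : List Step → ℕ → ℕ → ℕ
    A u l₁ l₂ = sumWords l₁ (λ a → negDyck a * sumWords l₂ (λ b → h (splice u a b)))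

⊗-cong : ∀ {f f′ g g′ : Poly} e → (∀ k → f k ≡ f′ k) → (∀ k → g k ≡ g′ k) → (f ⊗ g) e ≡ (f′ ⊗ g′) e
⊗-cong e f≗f′ g≗g′ = sumTo-cong e (λ a → cong₂ _*_ (f≗f′ a) (g≗g′ (e ∸ a)))

P≡genPoly-double : ∀ s m k → P s m k ≡ genPoly (double s) (flawedWeight m) peaks k
P≡genPoly-double s m k = trans (P≡genPoly s m k) (cong (λ L → genPoly L (flawedWeight m) peaks k) (sym (double≡2* s)))

P-diagonal≡genPoly-negDyck : ∀ s k → P s s k ≡ genPoly (double s) negDyck peaks k
P-diagonal≡genPoly-negDyck s k = trans (P≡genPoly-double s s k) (sumWords-cong-length (double s) λ w len →
  cong (_* δ (peaks w) k) (flawedWeight-negDyck s w (trans len (double≡2* s))))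

P-recurrence-zero : ∀ m r′ → P (m + suc r′) m 0 ≡ 0
P-recurrence-zero m r′ = begin
  P (m + suc r′) m 0                                                  ≡⟨ P≡genPoly (m + suc r′) m 0 ⟩
  genPoly (2 * (m + suc r′)) (flawedWeight m) peaks 0                 ≡⟨ genPoly-spliceSums m r′ 0 ⟩
  sumSplits (suc (m + r′)) (λ s₁ t → sumSplits (suc t) (spliceSum m 0 s₁))
    ≡⟨ sumSplits-cong (suc (m + r′)) (λ s₁ t →
         trans (sumSplits-cong (suc t) (spliceSum-zero m s₁)) (sumSplits-zero (suc t))) ⟩
  sumSplits (suc (m + r′)) (λ _ _ → 0)                                ≡⟨ sumSplits-zero (suc (m + r′)) ⟩
  0                                                                   ∎

P-recurrence-suc : ∀ m r′ e → P (m + suc r′) m (suc e)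
  ≡ sumTo m (λ i → sumTo r′ (λ j → ((P (m ∸ i) (m ∸ i) ⊗ P (r′ ∸ j) (r′ ∸ j)) ⊗ P (j + i) i) e))
P-recurrence-suc m r′ e = begin
  P (m + suc r′) m (suc e)                                            ≡⟨ P≡genPoly (m + suc r′) m (suc e) ⟩
  genPoly (2 * (m + suc r′)) (flawedWeight m) peaks (suc e)           ≡⟨ genPoly-spliceSums m r′ (suc e) ⟩
  sumSplits (suc (m + r′)) (λ s₁ t → sumSplits (suc t) (spliceSum m (suc e) s₁))
    ≡⟨ sumSplits-reindex m r′ (spliceSum m (suc e)) (spliceSum-too-many m (suc e)) (spliceSum-short-tail m (suc e)) ⟩
  sumTo m (λ i → sumTo r′ (λ j → spliceSum m (suc e) (m ∸ i) (r′ ∸ j) (j + i)))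
    ≡⟨ sumTo-cong-≤ m (λ i i≤m → sumTo-cong r′ (λ j → term i j i≤m)) ⟩
  sumTo m (λ i → sumTo r′ (λ j → ((P (m ∸ i) (m ∸ i) ⊗ P (r′ ∸ j) (r′ ∸ j)) ⊗ P (j + i) i) e)) ∎
  where
  term : ∀ i j → i ≤ m →
         spliceSum m (suc e) (m ∸ i) (r′ ∸ j) (j + i) ≡ ((P (m ∸ i) (m ∸ i) ⊗ P (r′ ∸ j) (r′ ∸ j)) ⊗ P (j + i) i) e
  term i j i≤m = trans (spliceSum-⊗ m e (m ∸ i) (r′ ∸ j) (j + i) (m∸n≤m m i)) (sym (⊗-cong e
    (λ c → ⊗-cong c (P-diagonal≡genPoly-negDyck (m ∸ i)) (P-diagonal≡genPoly-negDyck (r′ ∸ j)))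
    (λ c → trans (cong (λ x → P (j + i) x c) (sym (m∸[m∸n]≡n i≤m))) (P≡genPoly-double (j + i) (m ∸ (m ∸ i)) c))))

-- Nonpositive paths counted by peaks

countPeaks countPeaksU : ℕ → ℕ → Poly
countPeaks  d L = genPoly L (λ u → 𝟙 (nonposTo0 d u)) peaks
countPeaksU d L = genPoly L (λ u → 𝟙 (nonposTo0 d u)) (λ u → peaks (U ∷ u))

countPeaks-0 : ∀ L k → countPeaks 0 (suc L) k ≡ countPeaks 1 L k
countPeaks-0 L k = trans (sumWords-suc L _) (cong₂ _+_ (sumWords-0 L) refl)

countPeaks-suc : ∀ d L k → countPeaks (suc d) (suc L) k ≡ countPeaksU d L k + countPeaks (suc (suc d)) L k
countPeaks-suc d L k = sumWords-suc L _

countPeaksU-0-zero : ∀ L → countPeaksU 0 (suc L) 0 ≡ 0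
countPeaksU-0-zero L = trans (sumWords-suc L _)
  (cong₂ _+_ (sumWords-0 L) (sumWords-vanish L _ λ u _ → *-zeroʳ (𝟙 (nonposTo0 1 u))))

countPeaksU-0-suc : ∀ L k → countPeaksU 0 (suc L) (suc k) ≡ countPeaks 1 L k
countPeaksU-0-suc L k = trans (sumWords-suc L _) (cong₂ _+_ (sumWords-0 L) refl)

countPeaksU-suc-zero : ∀ d L → countPeaksU (suc d) (suc L) 0 ≡ countPeaksU d L 0
countPeaksU-suc-zero d L = trans (sumWords-suc L _) (trans
  (cong₂ _+_ refl (sumWords-vanish L _ λ u _ → *-zeroʳ (𝟙 (nonposTo0 (suc (suc d)) u))))
  (+-identityʳ _))

countPeaksU-suc-suc : ∀ d L k → countPeaksU (suc d) (suc L) (suc k) ≡ countPeaksU d L (suc k) + countPeaks (suc (suc d)) L k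
countPeaksU-suc-suc d L k = sumWords-suc L _

ups≤length : ∀ w → ups w ≤ length w
ups≤length []      = z≤n
ups≤length (U ∷ w) = s≤s (ups≤length w)
ups≤length (D ∷ w) = m≤n⇒m≤1+n (ups≤length w)

countPeaks-short : ∀ d L k → L < d → countPeaks d L k ≡ 0
countPeaks-short d L k L<d = sumWords-vanish L _ λ u len → cong (_* δ (peaks u) k) (cong 𝟙 (short u (subst (_< d) (sym len) L<d)))
  where
  short : ∀ u → length u < d → nonposTo0 d u ≡ false
  short u len<d with nonposTo0 d u in u↓
  ... | false = refl
  ... | true  = ⊥-elim (<⇒≱ len<d (+-cancelˡ-≤ (length u) d (length u)
                  (subst (_≤ length u + length u) (sym (nonposTo0-length d u u↓)) (+-mono-≤ (ups≤length u) (ups≤length u)))))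

binom : ℕ → ℕ → ℕ
binom n       zero    = 1
binom zero    (suc k) = 0
binom (suc n) (suc k) = binom n k + binom n (suc k)

-- binom₋₋ n k = binom (n − 1) (k − 1) and binom₋ n k = binom (n − 1) k, read as 0 when n − 1 or k − 1 is negative.
binom₋₋ : ℕ → ℕ → ℕ
binom₋₋ zero    _       = 0
binom₋₋ (suc n) zero    = 0
binom₋₋ (suc n) (suc k) = binom n k

binom₋ : ℕ → ℕ → ℕ
binom₋ zero    k = 0
binom₋ (suc n) k = binom n k

binom-pascal : ∀ n k → binom (suc n) k ≡ binom n k + binom₋₋ (suc n) k
binom-pascal n zero    = refl
binom-pascal n (suc k) = +-comm (binom n k) (binom n (suc k))

-- For L = d + 2h, countPeaks d L k = mainTerm d h k − correction d h k, and likewise for countPeaksU.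
mainTerm correction correctionU : ℕ → ℕ → ℕ → ℕ
mainTerm    d h k = binom (d + h) k * binom h k
correction  d h k = binom₋₋ (d + h) k * binom (suc h) (suc k)
correctionU d h k = binom (suc (d + h)) k * binom₋ h k

transfer₁ : ∀ {t x c C d p} → t ≡ x → x + c ≡ C → C + d ≡ p + c → t + d ≡ p
transfer₁ {x = x} {c} {C} {d} {p} refl x+c≡C C+d≡p+c = +-cancelʳ-≡ c (x + d) p (begin
  (x + d) + c ≡⟨ +-assoc x d c ⟩
  x + (d + c) ≡⟨ cong (x +_) (+-comm d c) ⟩
  x + (c + d) ≡⟨ sym (+-assoc x c d) ⟩
  (x + c) + d ≡⟨ cong (_+ d) x+c≡C ⟩
  C + d       ≡⟨ C+d≡p+c ⟩
  p + c       ∎)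

transfer₂ : ∀ {t x y c c′ C C′ d p} →
            t ≡ x + y → x + c ≡ C → y + c′ ≡ C′ → C + C′ + d ≡ p + c + c′ → t + d ≡ p
transfer₂ {x = x} {y} {c} {c′} {C} {C′} {d} {p} refl x+c≡C y+c′≡C′ balance = +-cancelʳ-≡ (c + c′) (x + y + d) p (begin
  (x + y + d) + (c + c′) ≡⟨ regroup x y d c c′ ⟩
  (x + c) + (y + c′) + d ≡⟨ cong₂ (λ a b → a + b + d) x+c≡C y+c′≡C′ ⟩
  C + C′ + d             ≡⟨ balance ⟩
  p + c + c′             ≡⟨ +-assoc p c c′ ⟩
  p + (c + c′)           ∎)
  where
  regroup : ∀ x y d c c′ → (x + y + d) + (c + c′) ≡ (x + c) + (y + c′) + d
  regroup = solve-∀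

closedForm-N-0 : ∀ h k → mainTerm 1 h k + correction 0 (suc h) k ≡ mainTerm 0 (suc h) k + correction 1 h k
closedForm-N-0 h k = identity (binom (suc h) k) (binom h k) (binom₋₋ (suc h) k) (binom (suc h) (suc k)) (binom-pascal h k)
  where
  identity : ∀ a b c e → a ≡ b + c → a * b + c * (a + e) ≡ a * a + c * e
  identity _ b c e refl = polynomial b c e
    where
    polynomial : ∀ b c e → (b + c) * b + c * ((b + c) + e) ≡ (b + c) * (b + c) + c * e
    polynomial = solve-∀

closedForm-U-0 : ∀ h k → mainTerm 1 h k + correctionU 0 (suc h) (suc k) ≡ mainTerm 0 (suc h) (suc k) + correction 1 h k
closedForm-U-0 h k = identity (binom (suc h) k) (binom h k) (binom₋₋ (suc h) k) (binom h (suc k)) (binom-pascal h k)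
  where
  identity : ∀ a b c f → a ≡ b + c → a * b + (a + (b + f)) * f ≡ (b + f) * (b + f) + c * (b + f)
  identity _ b c f refl = polynomial b c f
    where
    polynomial : ∀ b c f → (b + c) * b + ((b + c) + (b + f)) * f ≡ (b + f) * (b + f) + c * (b + f)
    polynomial = solve-∀

closedForm-N-flat : ∀ d k → mainTerm d 0 k + correction (suc d) 0 k ≡ mainTerm (suc d) 0 k + correctionU d 0 k
closedForm-N-flat d zero    = cong suc (sym (*-zeroʳ (binom (suc (d + 0)) 0)))
closedForm-N-flat d (suc k)
  rewrite *-zeroʳ (binom (d + 0) (suc k)) | *-zeroʳ (binom (d + 0) k) | *-zeroʳ (binom (suc (d + 0)) (suc k)) = refl

closedForm-U-flat : ∀ d k → mainTerm d 0 k + correctionU (suc d) 0 k ≡ mainTerm (suc d) 0 k + correctionU d 0 k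
closedForm-U-flat d zero    = refl
closedForm-U-flat d (suc k)
  rewrite *-zeroʳ (binom (d + 0) (suc k)) | *-zeroʳ (binom (suc (suc d + 0)) (suc k)) | *-zeroʳ (binom (suc (d + 0)) (suc k)) = refl

closedForm-N-suc : ∀ d h k → mainTerm d (suc h) k + mainTerm (suc (suc d)) h k + correction (suc d) (suc h) k
                             ≡ mainTerm (suc d) (suc h) k + correctionU d (suc h) k + correction (suc (suc d)) h k
closedForm-N-suc d h k rewrite +-suc d h =
  identity (binom (suc (d + h)) k) (binom₋₋ (suc (suc (d + h))) k) (binom (suc (suc (d + h))) k)
           (binom (suc h) k) (binom h k) (binom (suc h) (suc k)) (binom-pascal (suc (d + h)) k)
  where
  identity : ∀ x c y p q r → y ≡ x + c → x * p + y * q + c * (p + r) ≡ y * p + y * q + c * r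
  identity x c _ p q r refl = polynomial x c p q r
    where
    polynomial : ∀ x c p q r → x * p + (x + c) * q + c * (p + r) ≡ (x + c) * p + (x + c) * q + c * r
    polynomial = solve-∀

closedForm-U-suc : ∀ d h k → mainTerm d (suc h) (suc k) + mainTerm (suc (suc d)) h k + correctionU (suc d) (suc h) (suc k)
                             ≡ mainTerm (suc d) (suc h) (suc k) + correctionU d (suc h) (suc k) + correction (suc (suc d)) h k
closedForm-U-suc d h k rewrite +-suc d h =
  identity (binom (suc (d + h)) k) (binom (suc (d + h)) (suc k)) (binom₋₋ (suc (suc (d + h))) k)
           (binom (suc (suc (d + h))) k) (binom h k) (binom h (suc k)) (binom-pascal (suc (d + h)) k)
  where
  identity : ∀ a₀ a₁ c y n₀ n₁ → y ≡ a₀ + c →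
             a₁ * (n₀ + n₁) + y * n₀ + (y + (a₀ + a₁)) * n₁
             ≡ (a₀ + a₁) * (n₀ + n₁) + (a₀ + a₁) * n₁ + c * (n₀ + n₁)
  identity a₀ a₁ c _ n₀ n₁ refl = polynomial a₀ a₁ c n₀ n₁
    where
    polynomial : ∀ a₀ a₁ c n₀ n₁ → a₁ * (n₀ + n₁) + (a₀ + c) * n₀ + ((a₀ + c) + (a₀ + a₁)) * n₁
                                   ≡ (a₀ + a₁) * (n₀ + n₁) + (a₀ + a₁) * n₁ + c * (n₀ + n₁)
    polynomial = solve-∀

ClosedForm : ℕ → ℕ → ℕ → Set
ClosedForm d L h = ∀ k → (countPeaks d L k + correction d h k ≡ mainTerm d h k)
                       × (countPeaksU d L k + correctionU d h k ≡ mainTerm d h k)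

closedForm-step-0 : ∀ L h → ClosedForm 1 L h → ClosedForm 0 (suc L) (suc h)
closedForm-step-0 L h IH k = nP , uP k
  where
  nP = transfer₁ (countPeaks-0 L k) (proj₁ (IH k)) (closedForm-N-0 h k)
  uP : ∀ k → countPeaksU 0 (suc L) k + correctionU 0 (suc h) k ≡ mainTerm 0 (suc h) k
  uP zero    = cong (_+ correctionU 0 (suc h) 0) (countPeaksU-0-zero L)
  uP (suc j) = transfer₁ (countPeaksU-0-suc L j) (proj₁ (IH j)) (closedForm-U-0 h j)

closedForm-step-flat : ∀ d L → L ≡ d → ClosedForm d L 0 → ClosedForm (suc d) (suc L) 0
closedForm-step-flat d L L≡d IH k = nP , uP k
  where
  short : ∀ k → countPeaks (suc (suc d)) L k ≡ 0
  short k = countPeaks-short (suc (suc d)) L k (s≤s (m≤n⇒m≤1+n (≤-reflexive L≡d)))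
  nP = transfer₁ (trans (countPeaks-suc d L k) (trans (cong (countPeaksU d L k +_) (short k)) (+-identityʳ _)))
                 (proj₂ (IH k)) (closedForm-N-flat d k)
  uP : ∀ k → countPeaksU (suc d) (suc L) k + correctionU (suc d) 0 k ≡ mainTerm (suc d) 0 k
  uP zero    = transfer₁ (countPeaksU-suc-zero d L) (proj₂ (IH 0)) (closedForm-U-flat d 0)
  uP (suc j) = transfer₁ (trans (countPeaksU-suc-suc d L j) (trans (cong (countPeaksU d L (suc j) +_) (short j)) (+-identityʳ _)))
                         (proj₂ (IH (suc j))) (closedForm-U-flat d (suc j))

closedForm-step : ∀ d L h → ClosedForm d L (suc h) → ClosedForm (suc (suc d)) L h → ClosedForm (suc d) (suc L) (suc h)
closedForm-step d L h IHU IHN k = nP , uP k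
  where
  nP = transfer₂ (countPeaks-suc d L k) (proj₂ (IHU k)) (proj₁ (IHN k)) (closedForm-N-suc d h k)
  uP : ∀ k → countPeaksU (suc d) (suc L) k + correctionU (suc d) (suc h) k ≡ mainTerm (suc d) (suc h) k
  uP zero    = trans (cong (_+ 1) (countPeaksU-suc-zero d L)) (proj₂ (IHU 0))
  uP (suc j) = transfer₂ (countPeaksU-suc-suc d L j) (proj₂ (IHU (suc j))) (proj₁ (IHN j)) (closedForm-U-suc d h j)

closedForm : ∀ L d h → L ≡ d + double h → ClosedForm d L h
closedForm zero    zero    zero    _  zero    = cong (_+ 0) (sumWords-zero _) , cong₂ _+_ (sumWords-zero _) refl
closedForm zero    zero    zero    _  (suc k) = cong (_+ 0) (sumWords-zero _) , cong₂ _+_ (sumWords-zero _) (*-zeroʳ (binom 1 (suc k)))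
closedForm (suc L) zero    (suc h) eq = closedForm-step-0 L h (closedForm L 1 h (suc-injective eq))
closedForm (suc L) (suc d) zero    eq = closedForm-step-flat d L (trans (suc-injective eq) (+-identityʳ d))
                                          (closedForm L d 0 (suc-injective eq))
closedForm (suc L) (suc d) (suc h) eq = closedForm-step d L h (closedForm L d (suc h) (suc-injective eq))
  (closedForm L (suc (suc d)) h (trans (suc-injective eq) (trans (+-suc d _) (cong suc (+-suc d _)))))

binom≡C : ∀ n k → binom n k ≡ n C k
binom≡C n       zero    = refl
binom≡C zero    (suc k) = refl
binom≡C (suc n) (suc k) = trans (cong₂ _+_ (binom≡C n k) (binom≡C n (suc k))) (nCk+nC[k+1]≡[n+1]C[k+1] n k)

binom-vanish : ∀ n k → n < k → binom n k ≡ 0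
binom-vanish zero    (suc k) _         = refl
binom-vanish (suc n) (suc k) (s≤s n<k) = cong₂ _+_ (binom-vanish n k n<k) (binom-vanish n (suc k) (m≤n⇒m≤1+n n<k))

binom-absorb : ∀ n k → suc k * binom (suc n) (suc k) ≡ suc n * binom n k
binom-absorb zero    zero    = refl
binom-absorb zero    (suc k) = *-zeroʳ (suc (suc k))
binom-absorb (suc n) k = begin
  suc k * (binom (suc n) k + binom (suc n) (suc k))
    ≡⟨ *-distribˡ-+ (suc k) (binom (suc n) k) _ ⟩
  suc k * binom (suc n) k + suc k * binom (suc n) (suc k)
    ≡⟨ cong₂ (λ x y → binom (suc n) k + x + y) (k*binom k) (binom-absorb n k) ⟩
  binom (suc n) k + suc n * binom₋₋ (suc n) k + suc n * binom n k
    ≡⟨ factor (binom (suc n) k) (suc n) (binom₋₋ (suc n) k) (binom n k) ⟩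
  binom (suc n) k + suc n * (binom n k + binom₋₋ (suc n) k)
    ≡⟨ cong (λ x → binom (suc n) k + suc n * x) (sym (binom-pascal n k)) ⟩
  suc (suc n) * binom (suc n) k ∎
  where
  k*binom : ∀ k → k * binom (suc n) k ≡ suc n * binom₋₋ (suc n) k
  k*binom zero     = sym (*-zeroʳ (suc n))
  k*binom (suc k′) = binom-absorb n k′
  factor : ∀ b s c d → b + s * c + s * d ≡ b + s * (d + c)
  factor = solve-∀

-- (e + 1)(C(n+1,e)² − C(n,e−1) C(n+2,e+1)) = C(n,e) C(n+1,e),
-- by absorption k C(N,k) = N C(N−1,k−1) applied to C(n+1,e) and C(n+2,e+1).
narayana-identity : ∀ n e → suc e * mainTerm 0 (suc n) e ≡ binom n e * binom (suc n) e + suc e * correction 0 (suc n) e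
narayana-identity n zero    = refl
narayana-identity n (suc j) = begin
  suc (suc j) * (b * b)                    ≡⟨ step₁ (suc j) b ⟩
  (suc j * b + b) * b                      ≡⟨ cong (λ z → (z + b) * b) (binom-absorb n j) ⟩
  (suc n * c₀ + (c₀ + c₁)) * b             ≡⟨ step₂ (suc n) c₀ c₁ b ⟩
  c₁ * b + c₀ * (suc (suc n) * b)          ≡⟨ cong (λ z → c₁ * b + c₀ * z) (sym (binom-absorb (suc n) (suc j))) ⟩
  c₁ * b + c₀ * (suc (suc j) * b′)         ≡⟨ cong (c₁ * b +_) (x*[y*z]≡y*[x*z] c₀ (suc (suc j)) b′) ⟩
  c₁ * b + suc (suc j) * (c₀ * b′)         ∎
  where
  c₀ = binom n j
  c₁ = binom n (suc j)
  b  = binom (suc n) (suc j)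
  b′ = binom (suc (suc n)) (suc (suc j))
  step₁ : ∀ s b → suc s * (b * b) ≡ (s * b + b) * b
  step₁ = solve-∀
  step₂ : ∀ s c₀ c₁ b → (s * c₀ + (c₀ + c₁)) * b ≡ c₁ * b + c₀ * (suc s * b)
  step₂ = solve-∀

narayana : ∀ n e → suc e * P (suc n) (suc n) e ≡ binom n e * binom (suc n) e
narayana n e = +-cancelʳ-≡ (suc e * correction 0 (suc n) e) _ _ (begin
  suc e * P (suc n) (suc n) e + suc e * correction 0 (suc n) e
    ≡⟨ cong (λ x → suc e * x + suc e * correction 0 (suc n) e) (P-diagonal≡genPoly-negDyck (suc n) e) ⟩
  suc e * countPeaks 0 (double (suc n)) e + suc e * correction 0 (suc n) e
    ≡⟨ sym (*-distribˡ-+ (suc e) (countPeaks 0 (double (suc n)) e) (correction 0 (suc n) e)) ⟩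
  suc e * (countPeaks 0 (double (suc n)) e + correction 0 (suc n) e)
    ≡⟨ cong (suc e *_) (proj₁ (closedForm (double (suc n)) 0 (suc n) refl e)) ⟩
  suc e * mainTerm 0 (suc n) e
    ≡⟨ narayana-identity n e ⟩
  binom n e * binom (suc n) e + suc e * correction 0 (suc n) e ∎)

toℚ-÷ : ∀ x y e → suc e * x ≡ y → toℚ x ≡ (ℤ.+ y) ℚ./ suc e
toℚ-÷ x y e ex≡y = fromℚᵘ-cong {mkℚᵘ (ℤ.+ x) 0} {mkℚᵘ (ℤ.+ y) e} (*≡* (begin
  ℤ.+ x ℤ.* ℤ.+ suc e  ≡⟨ ℤ.pos-* x (suc e) ⟨
  ℤ.+ (x * suc e)      ≡⟨ cong ℤ.+_ (trans (*-comm x (suc e)) (trans ex≡y (sym (*-identityʳ y)))) ⟩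
  ℤ.+ (y * 1)          ≡⟨ ℤ.pos-* y 1 ⟩
  ℤ.+ y ℤ.* ℤ.+ 1      ∎))

P-diagonal-narayana : ∀ n e → toℚ (P (suc n) (suc n) e) ≡ narayanaCoeff (suc n) e
P-diagonal-narayana n e with suc e ≤? suc n
... | yes _   = toℚ-÷ _ _ e (trans (narayana n e) (cong₂ _*_ (binom≡C n e) (binom≡C (suc n) e)))
... | no e≰n  = cong toℚ (m*n≡0⇒m≡0 (P (suc n) (suc n) e) (suc e)
                   (trans (*-comm (P (suc n) (suc n) e) (suc e)) (trans (narayana n e) binom-product≡0)))
  where
  binom-product≡0 : binom n e * binom (suc n) e ≡ 0
  binom-product≡0 = cong (_* binom (suc n) e) (binom-vanish n e (≤-pred (≰⇒> e≰n)))

theorem3p6 : (m r : ℕ) →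
    (m ≡ 0 → r ≡ 0 → ∀ e → P (m + r) m e ≡ onePoly e)
    × (r ≡ 0 → 1 ≤ m → ∀ e → toℚ (P (m + r) m e) ≡ narayanaCoeff m e)
    × (1 ≤ r → ∀ e → P (m + r) m e
         ≡ xTimes (polySum m (λ i → polySum (r ∸ 1) (λ j →
              (P (m ∸ i) (m ∸ i) ⊗ P (r ∸ j ∸ 1) (r ∸ j ∸ 1)) ⊗ P (j + i) i))) e)
theorem3p6 m r = emptyPath , diagonal , recursion
  where
  emptyPath : m ≡ 0 → r ≡ 0 → ∀ e → P (m + r) m e ≡ onePoly e
  emptyPath refl refl zero    = refl
  emptyPath refl refl (suc e) = refl
  diagonal : r ≡ 0 → 1 ≤ m → ∀ e → toℚ (P (m + r) m e) ≡ narayanaCoeff m e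
  diagonal refl (s≤s _) e = trans (cong (λ x → toℚ (P x m e)) (+-identityʳ m)) (P-diagonal-narayana _ e)
  recursion : 1 ≤ r → ∀ e → P (m + r) m e ≡ xTimes (polySum m (λ i → polySum (r ∸ 1) (λ j →
                (P (m ∸ i) (m ∸ i) ⊗ P (r ∸ j ∸ 1) (r ∸ j ∸ 1)) ⊗ P (j + i) i))) e
  recursion (s≤s _) zero    = P-recurrence-zero m _
  recursion (s≤s {n = r′} _) (suc e) = trans (P-recurrence-suc m r′ e)
    (sumTo-cong m λ i → sumTo-cong-≤ r′ λ j j≤r′ →
      cong (λ l → ((P (m ∸ i) (m ∸ i) ⊗ P l l) ⊗ P (j + i) i) e) (sym (cong (_∸ 1) (+-∸-assoc 1 j≤r′))))
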